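{- Let $G$ be a finite simple graph on $n$ vertices. Then \begin{align*} d_{n-3}(G) &= \binom{n}{3} -\Bigl(i(G)\binom{n-1}{2}+\ell(G)(n-2)+n_2(G)\Bigr)\\ &\quad+\Bigl(\binom{i(G)}{2}(n-2)+i(G)\ell(G)+e_2(G)(n-2)+s(G)+m(G)+t_{22}(G)\Bigr)\\ &\quad-\Bigl(\binom{i(G)}{3}+i(G)e_2(G)+p_3(G)+c_3(G)\Bigr), \end{align*} where $i(G)$ is the number of isolated vertices, $\ell(G)$ is the number of leaves (vertices of degree $1$), $n_2(G)$ is the number of vertices of degree $2$, $e_2(G)$ is the number of connected components isomorphic to $K_2$, $s(G)$ is the number of unordered pairs of leaves with a common neighbor, $m(G)$ is the number of edges joining a leaf to a vertex of degree $2$, $t_{22}(G)$ is the number of unordered pairs of degree-$2$ vertices with equal closed neighborhoods, $p_3(G)$ is the number of connected components isomorphic to the path $P_3$ on three vertices, and $c_3(G)$ is the number of connected components isomorphic to $K_3$.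
   Context: A set $S\subseteq V(G)$ is dominating if every vertex of $G$ is in $S$ or adjacent to a vertex of $S$. For an integer $k$, $d_k(G)$ denotes the number of dominating sets of $G$ of size exactly $k$. The closed neighborhood $N[v]$ of a vertex $v$ is $v$ together with all its neighbors. Binomial coefficients $\binom{a}{b}$ are $0$ when $b<0$ or $b>a$. -}

module Defs where

open import Data.Nat using (ℕ; zero; suc; _≡ᵇ_; _<ᵇ_)
open import Data.Bool using (Bool; true; false; _∧_; _∨_; not; _xor_; if_then_else_)
open import Data.Fin using (Fin; zero; suc; toℕ) renaming (_≟_ to _≟ᶠ_)
open import Data.Fin.Subset using (Subset; ∣_∣)
open import Data.Vec using (Vec; []; _∷_; lookup)
open import Data.List using (List; []; _∷_; [_]; map; _++_; allFin; filterᵇ; length; concatMap)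
open import Data.Bool.ListAction using (all; any)
open import Data.Integer using (ℤ; +_) renaming (_≟_ to _≟ℤ_)
open import Relation.Nullary.Decidable using (⌊_⌋)
open import Data.Product using (_×_; _,_)
open import Relation.Binary.PropositionalEquality using (_≡_; refl)

_⇔ᵇ_ : Bool → Bool → Bool
a ⇔ᵇ b = not (a xor b)

_⇒ᵇ_ : Bool → Bool → Bool
a ⇒ᵇ b = not a ∨ b

_==ᶠ_ : ∀ {n} → Fin n → Fin n → Bool
u ==ᶠ v = ⌊ u ≟ᶠ v ⌋

count : ∀ {a} {A : Set a} → (A → Bool) → List A → ℕ
count p xs = length (filterᵇ p xs)

allSubsets : (n : ℕ) → List (Subset n)
allSubsets zero = [ [] ]
allSubsets (suc n) = map (true ∷_) (allSubsets n) ++ map (false ∷_) (allSubsets n)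

allMaps : (m n : ℕ) → List (Vec (Fin n) m)
allMaps zero n = [ [] ]
allMaps (suc m) n = concatMap (λ x → map (x ∷_) (allMaps m n)) (allFin n)

record SimpleGraph (n : ℕ) : Set where
  field
    adj    : Fin n → Fin n → Bool
    sym    : ∀ u v → adj u v ≡ adj v u
    irrefl : ∀ v → adj v v ≡ false
open SimpleGraph public

module _ {n : ℕ} (G : SimpleGraph n) where

  vs : List (Fin n)
  vs = allFin n

  isDominating : Subset n → Bool
  isDominating S = all (λ v → lookup S v ∨ any (λ u → lookup S u ∧ adj G u v) vs) vs

  -- d_k(G): number of dominating sets of size exactly k (k an integer; 0 if k < 0)
  domCount : ℤ → ℕ
  domCount k = count (λ S → isDominating S ∧ ⌊ (+ ∣ S ∣) ≟ℤ k ⌋) (allSubsets n)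

  degree : Fin n → ℕ
  degree v = count (adj G v) vs

  hasDeg : ℕ → Fin n → Bool
  hasDeg d v = degree v ≡ᵇ d

  isolatedCount : ℕ
  isolatedCount = count (hasDeg 0) vs

  leafCount : ℕ
  leafCount = count (hasDeg 1) vs

  deg2Count : ℕ
  deg2Count = count (hasDeg 2) vs

  allPairs : List (Fin n × Fin n)
  allPairs = concatMap (λ u → map (u ,_) vs) vs

  pairCount : (Fin n → Fin n → Bool) → ℕ
  pairCount p = count (λ { (u , v) → (toℕ u <ᵇ toℕ v) ∧ p u v }) allPairs

  isLeaf isDeg2 : Fin n → Bool
  isLeaf = hasDeg 1
  isDeg2 = hasDeg 2

  leafPairCommonNbr : ℕ
  leafPairCommonNbr = pairCount (λ u v → isLeaf u ∧ isLeaf v ∧ any (λ w → adj G u w ∧ adj G v w) vs)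

  leafDeg2Edges : ℕ
  leafDeg2Edges = pairCount (λ u v → adj G u v ∧ ((isLeaf u ∧ isDeg2 v) ∨ (isDeg2 u ∧ isLeaf v)))

  closedNbr : Fin n → Fin n → Bool
  closedNbr u w = (u ==ᶠ w) ∨ adj G u w

  deg2PairsSameClosedNbr : ℕ
  deg2PairsSameClosedNbr =
    pairCount (λ u v → isDeg2 u ∧ isDeg2 v ∧ all (λ w → closedNbr u w ⇔ᵇ closedNbr v w) vs)

  walkWithin : ℕ → Fin n → Fin n → Bool
  walkWithin zero u v = u ==ᶠ v
  walkWithin (suc k) u v = walkWithin k u v ∨ any (λ w → walkWithin k u w ∧ adj G w v) vs

  -- u and v are connected by a walk (walks of length ≤ n suffice on n vertices)
  reachable : Fin n → Fin n → Bool
  reachable = walkWithin n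

  isComponent : Subset n → Bool
  isComponent C = any (λ v → lookup C v ∧ all (λ u → lookup C u ⇔ᵇ reachable v u) vs) vs

  inducedIsoTo : ∀ {m} → SimpleGraph m → Subset n → Bool
  inducedIsoTo {m} H C = any isIso (allMaps m n)
    where
    ms : List (Fin m)
    ms = allFin m
    isIso : Vec (Fin n) m → Bool
    isIso f = all (λ i → all (λ j → (lookup f i ==ᶠ lookup f j) ⇒ᵇ (i ==ᶠ j)) ms) ms
            ∧ all (λ u → lookup C u ⇔ᵇ any (λ i → lookup f i ==ᶠ u) ms) vs
            ∧ all (λ i → all (λ j → adj G (lookup f i) (lookup f j) ⇔ᵇ adj H i j) ms) ms

  componentsIsoTo : ∀ {m} → SimpleGraph m → ℕ
  componentsIsoTo H = count (λ C → isComponent C ∧ inducedIsoTo H C) (allSubsets n)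

K₂ : SimpleGraph 2
K₂ = record { adj = a ; sym = s ; irrefl = i }
  where
  a : Fin 2 → Fin 2 → Bool
  a u v = not (u ==ᶠ v)
  s : ∀ u v → a u v ≡ a v u
  s zero zero = refl
  s zero (suc zero) = refl
  s (suc zero) zero = refl
  s (suc zero) (suc zero) = refl
  i : ∀ v → a v v ≡ false
  i zero = refl
  i (suc zero) = refl

K₃ : SimpleGraph 3
K₃ = record { adj = a ; sym = s ; irrefl = i }
  where
  a : Fin 3 → Fin 3 → Bool
  a u v = not (u ==ᶠ v)
  s : ∀ u v → a u v ≡ a v u
  s zero zero = refl
  s zero (suc zero) = refl
  s zero (suc (suc zero)) = refl
  s (suc zero) zero = refl
  s (suc zero) (suc zero) = refl
  s (suc zero) (suc (suc zero)) = refl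
  s (suc (suc zero)) zero = refl
  s (suc (suc zero)) (suc zero) = refl
  s (suc (suc zero)) (suc (suc zero)) = refl
  i : ∀ v → a v v ≡ false
  i zero = refl
  i (suc zero) = refl
  i (suc (suc zero)) = refl

P₃ : SimpleGraph 3
P₃ = record { adj = a ; sym = s ; irrefl = i }
  where
  a : Fin 3 → Fin 3 → Bool
  a zero (suc zero) = true
  a (suc zero) zero = true
  a (suc zero) (suc (suc zero)) = true
  a (suc (suc zero)) (suc zero) = true
  a _ _ = false
  s : ∀ u v → a u v ≡ a v u
  s zero zero = refl
  s zero (suc zero) = refl
  s zero (suc (suc zero)) = refl
  s (suc zero) zero = refl
  s (suc zero) (suc zero) = refl
  s (suc zero) (suc (suc zero)) = refl
  s (suc (suc zero)) zero = refl
  s (suc (suc zero)) (suc zero) = refl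
  s (suc (suc zero)) (suc (suc zero)) = refl
  i : ∀ v → a v v ≡ false
  i zero = refl
  i (suc zero) = refl
  i (suc (suc zero)) = refl

k2Components p3Components k3Components : ∀ {n} → SimpleGraph n → ℕ
k2Components G = componentsIsoTo G K₂
p3Components G = componentsIsoTo G P₃
k3Components G = componentsIsoTo G K₃

-- By complementation, d_{n-3}(G) counts the triples T = {u, v, w} none of whose vertices is trapped by T,
-- where x ∈ T is trapped if N(x) ⊆ T (nothing outside T dominates x). Inclusion–exclusion over the trapped
-- vertices gives d_{n-3}(G) = C(n,3) − Σ₁ + Σ₂ − Σ₃, Σₖ counting triples with k marked trapped vertices. A
-- vertex x of degree 0, 1, 2 is trapped by C(n−1,2), n − 2, 1 triples, and by none if its degree is
-- larger. A pair {x, y} is trapped by n − 2 triples if it is two isolated vertices or a K₂ component, and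
-- by exactly one if it is an isolated vertex and a leaf, two leaves with a common neighbour, a leaf
-- adjacent to a vertex of degree 2, or two vertices of degree 2 with N[x] = N[y], and by none otherwise. A
-- triple trapping all its vertices is a union of components: three isolated vertices, an isolated vertex
-- and a K₂, a P₃ or a K₃.

module Submission where

open import Defs hiding (sym)
open import Data.Bool using (Bool; true; false; _∧_; _∨_; not; T)
open import Data.Bool.Properties
  using (⇔→≡; ∧-conicalˡ; ∧-conicalʳ; ∨-conicalˡ; ∨-conicalʳ; ∧-comm; ∨-comm; ∧-idem; ∧-identityʳ; ∨-identityʳ;
         ∧-zeroʳ; ∨-zeroʳ; not-injective; xor-same; xor-comm)
open import Data.Bool.ListAction using (all; any)
open import Data.Empty using (⊥-elim)
open import Data.Fin using (Fin; zero; suc; toℕ) renaming (_≟_ to _≟ᶠ_)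
open import Data.Fin.Patterns using (0F; 1F; 2F)
open import Data.Fin.Properties using (suc-injective)
open import Data.Fin.Subset using (Subset; ∣_∣; ∁)
open import Data.Fin.Subset.Properties using (∣p∣≤n; ∣∁p∣≡n∸∣p∣)
open import Data.Integer using (ℤ; +_; _-_) renaming (_≟_ to _≟ℤ_)
open import Data.Integer.Properties using (+-injective; pos-+; pos-*)
open import Data.List using (List; []; _∷_; map; _++_; concatMap; tabulate; allFin)
open import Data.Nat as ℕ using (ℕ; zero; suc; _∸_; _≤_; _≡ᵇ_; _<ᵇ_; z≤n; s≤s; pred) renaming (_≟_ to _≟ℕ_)
open import Data.Nat.Combinatorics using (_C_; nCk+nC[k+1]≡[n+1]C[k+1]; nC1≡n)
open import Data.Nat.Properties
  using (+-*-semiring; +-assoc; +-comm; *-comm; *-distribˡ-+; *-suc; *-zeroʳ; +-identityʳ; +-mono-≤; m+n∸m≡n;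
         m∸n+n≡m; +-cancelˡ-≡; ≤-trans; ≤-pred; ≤∧≢⇒<; ≤-reflexive; ≡ᵇ⇒≡)
open import Data.Product using (Σ-syntax; _×_; _,_; proj₁; proj₂)
open import Data.Sum using (_⊎_; inj₁; inj₂; [_,_]′)
open import Data.Vec using (Vec; []; _∷_; lookup) renaming (tabulate to tabulateᵛ)
open import Data.Vec.Properties using (tabulate-cong; lookup∘tabulate; lookup-map)
open import Algebra.Properties.Semiring.Sum +-*-semiring
  using (sum; sum-cong-≗; ∑-distrib-+; *-distribˡ-sum; sum-replicate-zero)
open import Function.Base using (case_of_)
open import Function.Bundles using (mk⇔)
open import Relation.Binary.PropositionalEquality
  using (_≡_; _≢_; refl; sym; trans; cong; cong₂; subst; module ≡-Reasoning)
open import Relation.Nullary using (yes; no)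
open import Relation.Nullary.Decidable using (⌊_⌋; isYes≗does; dec-true; dec-false; ⌊⌋-map′; toWitness)

-- ℕ's _+_ and _*_ are opened only inside this block, so that the statement of theorem4 can use ℤ's.
module _ where

  open import Data.Nat using (_+_; _*_)
  open import Data.Nat.Tactic.RingSolver using (solve-∀)

  infixr 7 _·_
  _·_ : Bool → ℕ → ℕ
  true  · k = k
  false · k = 0

  ·-zeroʳ : ∀ b → b · 0 ≡ 0
  ·-zeroʳ true  = refl
  ·-zeroʳ false = refl

  ·-∧ : ∀ a b → a · (b · 1) ≡ (a ∧ b) · 1
  ·-∧ true  b = refl
  ·-∧ false b = refl

  ·-as-* : ∀ b k → b · k ≡ (b · 1) * k
  ·-as-* true  k = sym (+-identityʳ k)
  ·-as-* false k = refl

  ·1-∨ : ∀ a b → (a ∧ b) ≡ false → (a ∨ b) · 1 ≡ a · 1 + b · 1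
  ·1-∨ false b _ = refl
  ·1-∨ true false _ = refl

  ·1-∨≤ : ∀ a b → (a ∨ b) · 1 ≤ a · 1 + b · 1
  ·1-∨≤ false false = z≤n
  ·1-∨≤ false true  = s≤s z≤n
  ·1-∨≤ true  b     = s≤s z≤n

  ·1-not : ∀ b → b · 1 + not b · 1 ≡ 1
  ·1-not true  = refl
  ·1-not false = refl

  ·1-mono : ∀ {a b} → (a ≡ true → b ≡ true) → a · 1 ≤ b · 1
  ·1-mono {false} _ = z≤n
  ·1-mono {true}  h rewrite h refl = s≤s z≤n

  ≡ᵇ-true⇒≡ : ∀ {a b} → (a ≡ᵇ b) ≡ true → a ≡ b
  ≡ᵇ-true⇒≡ {a} {b} e = ≡ᵇ⇒≡ a b (subst T (sym e) _)

  ≡⇒≡ᵇ-true : ∀ {a b} → a ≡ b → (a ≡ᵇ b) ≡ true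
  ≡⇒≡ᵇ-true {zero}  refl = refl
  ≡⇒≡ᵇ-true {suc a} refl = ≡⇒≡ᵇ-true {a} refl

  ∧-intro : ∀ {a b} → a ≡ true → b ≡ true → (a ∧ b) ≡ true
  ∧-intro refl refl = refl

  ⇒ᵇ-intro : ∀ {a b} → (a ≡ true → b ≡ true) → (a ⇒ᵇ b) ≡ true
  ⇒ᵇ-intro {false} h = refl
  ⇒ᵇ-intro {true}  h = cong (λ b → not true ∨ b) (h refl)

  ⇒ᵇ-elim : ∀ {a b} → (a ⇒ᵇ b) ≡ true → a ≡ true → b ≡ true
  ⇒ᵇ-elim h refl = h

  ∨-swapˡ : ∀ a b c → (a ∨ (b ∨ c)) ≡ (b ∨ (a ∨ c))
  ∨-swapˡ false b     c = refl
  ∨-swapˡ true  false c = refl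
  ∨-swapˡ true  true  c = refl

  ⇔ᵇ-refl : ∀ a → (a ⇔ᵇ a) ≡ true
  ⇔ᵇ-refl a = cong not (xor-same a)

  ⇔ᵇ-comm : ∀ a b → (a ⇔ᵇ b) ≡ (b ⇔ᵇ a)
  ⇔ᵇ-comm a b = cong not (xor-comm a b)

  contraposeᵇ : ∀ {b c} → (b ≡ true → c ≡ true) → c ≡ false → b ≡ false
  contraposeᵇ {false} h e = refl
  contraposeᵇ {true}  h e = trans (sym (h refl)) e

  ∨-elim₃ : ∀ {a} {X : Set a} {p q r : Bool} → (p ∨ q ∨ r) ≡ true → (p ≡ true → X) → (q ≡ true → X) → (r ≡ true → X) → X
  ∨-elim₃ {p = true}                    e f g h = f refl
  ∨-elim₃ {p = false} {true}            e f g h = g refl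
  ∨-elim₃ {p = false} {false} {true}    e f g h = h refl

  ∨-introˡ : ∀ {a} b → a ≡ true → (a ∨ b) ≡ true
  ∨-introˡ b refl = refl

  ∨-introʳ : ∀ a {b} → b ≡ true → (a ∨ b) ≡ true
  ∨-introʳ a refl = ∨-zeroʳ a

  ⇔ᵇ⇒≡ : ∀ {a b} → (a ⇔ᵇ b) ≡ true → a ≡ b
  ⇔ᵇ⇒≡ {false} {false} _ = refl
  ⇔ᵇ⇒≡ {true}  {true}  _ = refl

  ≡⇒⇔ᵇ : ∀ {a b} → a ≡ b → (a ⇔ᵇ b) ≡ true
  ≡⇒⇔ᵇ {a} refl = ⇔ᵇ-refl a

  ⇒ᵇ-true : ∀ a → (a ⇒ᵇ true) ≡ true
  ⇒ᵇ-true a = ∨-zeroʳ (not a)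

  inclusion-exclusion₃ : ∀ a b c →
    (not a ∧ not b ∧ not c) · 1 + (a · 1 + b · 1 + c · 1) + (a ∧ b ∧ c) · 1 ≡ 1 + ((a ∧ b) · 1 + (a ∧ c) · 1 + (b ∧ c) · 1)
  inclusion-exclusion₃ false false false = refl
  inclusion-exclusion₃ false false true  = refl
  inclusion-exclusion₃ false true  false = refl
  inclusion-exclusion₃ false true  true  = refl
  inclusion-exclusion₃ true  false false = refl
  inclusion-exclusion₃ true  false true  = refl
  inclusion-exclusion₃ true  true  false = refl
  inclusion-exclusion₃ true  true  true  = refl

  ·1-∨₃ : ∀ a b c → (a ∧ b) ≡ false → (a ∧ c) ≡ false → (b ∧ c) ≡ false → (a ∨ b ∨ c) · 1 ≡ a · 1 + b · 1 + c · 1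
  ·1-∨₃ false false false _ _ _ = refl
  ·1-∨₃ false false true  _ _ _ = refl
  ·1-∨₃ false true  false _ _ _ = refl
  ·1-∨₃ true  false false _ _ _ = refl
  ·1-∨₃ false true  true  _ _ ()
  ·1-∨₃ true  true  c     () _ _
  ·1-∨₃ true  false true  _ () _

  ==ᶠ-refl : ∀ {n} (x : Fin n) → (x ==ᶠ x) ≡ true
  ==ᶠ-refl x = trans (isYes≗does (x ≟ᶠ x)) (dec-true (x ≟ᶠ x) refl)

  ==ᶠ⇒≡ : ∀ {n} {x y : Fin n} → (x ==ᶠ y) ≡ true → x ≡ y
  ==ᶠ⇒≡ {x = x} {y} e with x ≟ᶠ y | e
  ... | yes x≡y | _ = x≡y
  ... | no _    | ()

  ≡⇒==ᶠ : ∀ {n} {x y : Fin n} → x ≡ y → (x ==ᶠ y) ≡ true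
  ≡⇒==ᶠ {x = x} refl = ==ᶠ-refl x

  ≢⇒==ᶠ-false : ∀ {n} {x y : Fin n} → x ≢ y → (x ==ᶠ y) ≡ false
  ≢⇒==ᶠ-false {x = x} {y} x≢y = trans (isYes≗does (x ≟ᶠ y)) (dec-false (x ≟ᶠ y) x≢y)

  ==ᶠ-sym : ∀ {n} (x y : Fin n) → (x ==ᶠ y) ≡ (y ==ᶠ x)
  ==ᶠ-sym x y = ⇔→≡ (mk⇔ (λ e → ≡⇒==ᶠ (sym (==ᶠ⇒≡ e))) (λ e → ≡⇒==ᶠ (sym (==ᶠ⇒≡ e))))

  ==ᶠ-suc : ∀ {n} (x y : Fin n) → (Fin.suc x ==ᶠ suc y) ≡ (x ==ᶠ y)
  ==ᶠ-suc x y = ⌊⌋-map′ _ _ (x ≟ᶠ y)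

  all-tabulate⇒ : ∀ {n a} {A : Set a} (p : A → Bool) (f : Fin n → A) →
                  all p (tabulate f) ≡ true → ∀ x → p (f x) ≡ true
  all-tabulate⇒ p f e zero    = ∧-conicalˡ _ _ e
  all-tabulate⇒ p f e (suc x) = all-tabulate⇒ p (λ x → f (suc x)) (∧-conicalʳ _ _ e) x

  ⇒all-tabulate : ∀ {n a} {A : Set a} (p : A → Bool) (f : Fin n → A) →
                  (∀ x → p (f x) ≡ true) → all p (tabulate f) ≡ true
  ⇒all-tabulate {zero}  p f h = refl
  ⇒all-tabulate {suc n} p f h rewrite h zero = ⇒all-tabulate p (λ x → f (suc x)) (λ x → h (suc x))

  any-tabulate⇒ : ∀ {n a} {A : Set a} (p : A → Bool) (f : Fin n → A) →
                  any p (tabulate f) ≡ true → Σ[ x ∈ Fin n ] p (f x) ≡ true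
  any-tabulate⇒ {suc n} p f e with p (f zero) in eq
  ... | true  = zero , eq
  ... | false with x , px ← any-tabulate⇒ p (λ x → f (suc x)) e = suc x , px

  ⇒any-tabulate : ∀ {n a} {A : Set a} (p : A → Bool) (f : Fin n → A) (x : Fin n) →
                  p (f x) ≡ true → any p (tabulate f) ≡ true
  ⇒any-tabulate p f zero h rewrite h = refl
  ⇒any-tabulate p f (suc x) h with p (f zero)
  ... | true  = refl
  ... | false = ⇒any-tabulate p (λ x → f (suc x)) x h

  module _ {n : ℕ} where

    all⇒∀ : (p : Fin n → Bool) → all p (allFin n) ≡ true → ∀ x → p x ≡ true
    all⇒∀ p = all-tabulate⇒ p (λ x → x)

    ∀⇒all : (p : Fin n → Bool) → (∀ x → p x ≡ true) → all p (allFin n) ≡ true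
    ∀⇒all p = ⇒all-tabulate p (λ x → x)

    any⇒∃ : (p : Fin n → Bool) → any p (allFin n) ≡ true → Σ[ x ∈ Fin n ] p x ≡ true
    any⇒∃ p = any-tabulate⇒ p (λ x → x)

    ∃⇒any : (p : Fin n → Bool) (x : Fin n) → p x ≡ true → any p (allFin n) ≡ true
    ∃⇒any p = ⇒any-tabulate p (λ x → x)

    all-cong : {p q : Fin n → Bool} → (∀ x → p x ≡ q x) → all p (allFin n) ≡ all q (allFin n)
    all-cong {p} {q} e = ⇔→≡ (mk⇔ (λ h → ∀⇒all q (λ x → trans (sym (e x)) (all⇒∀ p h x)))
                                  (λ h → ∀⇒all p (λ x → trans (e x) (all⇒∀ q h x))))

    any-cong : {p q : Fin n → Bool} → (∀ x → p x ≡ q x) → any p (allFin n) ≡ any q (allFin n)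
    any-cong {p} {q} e = ⇔→≡ (mk⇔ (λ h → let x , px = any⇒∃ p h in ∃⇒any q x (trans (sym (e x)) px))
                                  (λ h → let x , qx = any⇒∃ q h in ∃⇒any p x (trans (e x) qx)))

  any-not : ∀ {a} {A : Set a} (p : A → Bool) (xs : List A) → any (λ y → not (p y)) xs ≡ not (all p xs)
  any-not p []       = refl
  any-not p (x ∷ xs) with p x
  ... | true  = any-not p xs
  ... | false = refl

  any-single : ∀ {n} (a : Fin n) (q : Fin n → Bool) → any (λ w → (w ==ᶠ a) ∧ q w) (allFin n) ≡ q a
  any-single a q = ⇔→≡ (mk⇔ (λ h → let w , hw = any⇒∃ _ h in
                                    subst (λ t → q t ≡ true) (==ᶠ⇒≡ (∧-conicalˡ _ _ hw)) (∧-conicalʳ (w ==ᶠ a) _ hw))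
                            (λ h → ∃⇒any _ a (subst (λ t → (t ∧ q a) ≡ true) (sym (==ᶠ-refl a)) h)))

  all-false-at : ∀ {n} (p : Fin n → Bool) (w : Fin n) → p w ≡ false → all p (allFin n) ≡ false
  all-false-at p w pw with all p (allFin _) in e
  ... | false = refl
  ... | true with () ← trans (sym pw) (all⇒∀ p e w)

  any-++ : ∀ {a} {A : Set a} (p : A → Bool) (xs ys : List A) → any p (xs ++ ys) ≡ (any p xs ∨ any p ys)
  any-++ p []       ys = refl
  any-++ p (x ∷ xs) ys with p x
  ... | true  = refl
  ... | false = any-++ p xs ys

  any-map : ∀ {a b} {A : Set a} {B : Set b} (p : B → Bool) (f : A → B) (xs : List A) → any p (map f xs) ≡ any (λ x → p (f x)) xs
  any-map p f []       = refl
  any-map p f (x ∷ xs) = cong (p (f x) ∨_) (any-map p f xs)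

  any⇒witness : ∀ {a} {A : Set a} (p : A → Bool) (xs : List A) → any p xs ≡ true → Σ[ x ∈ A ] p x ≡ true
  any⇒witness p (x ∷ xs) e with p x in px
  ... | true  = x , px
  ... | false = any⇒witness p xs e

  any-concatMap : ∀ {a} {A : Set a} (p : A → Bool) {k n} (h : Fin k → Fin n) (g : Fin n → List A) (i : Fin k) →
                  any p (g (h i)) ≡ true → any p (concatMap g (tabulate h)) ≡ true
  any-concatMap p h g zero    e = trans (any-++ p (g (h zero)) _) (∨-introˡ _ e)
  any-concatMap p h g (suc i) e = trans (any-++ p (g (h zero)) _) (∨-introʳ _ (any-concatMap p (λ j → h (suc j)) g i e))

  any-allMaps : ∀ {m n} (p : Vec (Fin n) m → Bool) (f : Vec (Fin n) m) → p f ≡ true → any p (allMaps m n) ≡ true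
  any-allMaps {zero}      p []      e = ∨-introˡ false e
  any-allMaps {suc m} {n} p (x ∷ f) e = any-concatMap p (λ i → i) (λ x → map (x ∷_) (allMaps m n)) x
    (trans (any-map p (x ∷_) (allMaps m n)) (any-allMaps (λ g → p (x ∷ g)) f e))

  sum-zero : ∀ {n} (f : Fin n → ℕ) → (∀ x → f x ≡ 0) → sum f ≡ 0
  sum-zero {n} f e = trans (sum-cong-≗ e) (sum-replicate-zero n)

  sum-single : ∀ {n} (a : Fin n) (f : Fin n → ℕ) → (∀ z → z ≢ a → f z ≡ 0) → sum f ≡ f a
  sum-single zero    f h = trans (cong (_+_ (f zero)) (sum-zero _ (λ x → h (suc x) (λ ())))) (+-identityʳ _)
  sum-single (suc a) f h = trans (cong (_+ sum (λ x → f (suc x))) (h zero (λ ())))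
                                 (sum-single a (λ x → f (suc x)) (λ z z≢a → h (suc z) (λ e → z≢a (suc-injective e))))

  sum-mono-≤ : ∀ {n} {f g : Fin n → ℕ} → (∀ x → f x ≤ g x) → sum f ≤ sum g
  sum-mono-≤ {zero}  h = z≤n
  sum-mono-≤ {suc n} h = +-mono-≤ (h zero) (sum-mono-≤ (λ x → h (suc x)))

  -- Sums over the pairs x < y and over the triples x < y < z of Fin n.
  sumPairs : ∀ {n} → (Fin n → Fin n → ℕ) → ℕ
  sumPairs {zero}  f = 0
  sumPairs {suc n} f = sum (λ y → f zero (suc y)) + sumPairs (λ x y → f (suc x) (suc y))

  sumTriples : ∀ {n} → (Fin n → Fin n → Fin n → ℕ) → ℕ
  sumTriples {zero}  f = 0
  sumTriples {suc n} f = sumPairs (λ y z → f zero (suc y) (suc z)) + sumTriples (λ x y z → f (suc x) (suc y) (suc z))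

  private
    interchange : ∀ a b c d → (a + b) + (c + d) ≡ (a + c) + (b + d)
    interchange = solve-∀

  sumPairs-cong≢ : ∀ {n} {f g : Fin n → Fin n → ℕ} → (∀ x y → x ≢ y → f x y ≡ g x y) → sumPairs f ≡ sumPairs g
  sumPairs-cong≢ {zero}  e = refl
  sumPairs-cong≢ {suc n} e = cong₂ _+_ (sum-cong-≗ (λ y → e zero (suc y) (λ ())))
                                       (sumPairs-cong≢ (λ x y x≢y → e (suc x) (suc y) (λ p → x≢y (suc-injective p))))

  sumPairs-cong : ∀ {n} {f g : Fin n → Fin n → ℕ} → (∀ x y → f x y ≡ g x y) → sumPairs f ≡ sumPairs g
  sumPairs-cong e = sumPairs-cong≢ (λ x y _ → e x y)

  sumPairs-+ : ∀ {n} (f g : Fin n → Fin n → ℕ) → sumPairs (λ x y → f x y + g x y) ≡ sumPairs f + sumPairs g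
  sumPairs-+ {zero}  f g = refl
  sumPairs-+ {suc n} f g = trans (cong₂ _+_ (∑-distrib-+ (λ y → f zero (suc y)) (λ y → g zero (suc y)))
                                            (sumPairs-+ (λ x y → f (suc x) (suc y)) (λ x y → g (suc x) (suc y))))
                                 (interchange (sum (λ y → f zero (suc y))) (sum (λ y → g zero (suc y))) _ _)

  sumPairs-zero : ∀ {n} → sumPairs {n} (λ _ _ → 0) ≡ 0
  sumPairs-zero {zero}  = refl
  sumPairs-zero {suc n} = cong₂ _+_ (sum-replicate-zero n) (sumPairs-zero {n})

  sumPairs-*ˡ : ∀ {n} k (f : Fin n → Fin n → ℕ) → sumPairs (λ x y → k * f x y) ≡ k * sumPairs f
  sumPairs-*ˡ {zero}  k f = sym (*-zeroʳ k)
  sumPairs-*ˡ {suc n} k f = trans (cong₂ _+_ (sym (*-distribˡ-sum k (λ y → f zero (suc y))))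
                                             (sumPairs-*ˡ k (λ x y → f (suc x) (suc y))))
                                  (sym (*-distribˡ-+ k _ _))

  sumTriples-cong≢ : ∀ {n} {f g : Fin n → Fin n → Fin n → ℕ} →
                     (∀ x y z → x ≢ y → x ≢ z → y ≢ z → f x y z ≡ g x y z) → sumTriples f ≡ sumTriples g
  sumTriples-cong≢ {zero}  e = refl
  sumTriples-cong≢ {suc n} e =
    cong₂ _+_ (sumPairs-cong≢ (λ y z y≢z → e zero (suc y) (suc z) (λ ()) (λ ()) (λ p → y≢z (suc-injective p))))
              (sumTriples-cong≢ (λ x y z x≢y x≢z y≢z → e (suc x) (suc y) (suc z) (λ p → x≢y (suc-injective p))
                                                          (λ p → x≢z (suc-injective p)) (λ p → y≢z (suc-injective p))))

  sumTriples-cong : ∀ {n} {f g : Fin n → Fin n → Fin n → ℕ} → (∀ x y z → f x y z ≡ g x y z) → sumTriples f ≡ sumTriples g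
  sumTriples-cong e = sumTriples-cong≢ (λ x y z _ _ _ → e x y z)

  sumTriples-+ : ∀ {n} (f g : Fin n → Fin n → Fin n → ℕ) →
                 sumTriples (λ x y z → f x y z + g x y z) ≡ sumTriples f + sumTriples g
  sumTriples-+ {zero}  f g = refl
  sumTriples-+ {suc n} f g =
    trans (cong₂ _+_ (sumPairs-+ (λ y z → f zero (suc y) (suc z)) (λ y z → g zero (suc y) (suc z)))
                     (sumTriples-+ (λ x y z → f (suc x) (suc y) (suc z)) (λ x y z → g (suc x) (suc y) (suc z))))
          (interchange (sumPairs (λ y z → f zero (suc y) (suc z))) (sumPairs (λ y z → g zero (suc y) (suc z))) _ _)

  card : ∀ {n} → (Fin n → Bool) → ℕ
  card p = sum (λ x → p x · 1)

  module _ {n : ℕ} where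

    card-cong : {p q : Fin n → Bool} → (∀ x → p x ≡ q x) → card p ≡ card q
    card-cong e = sum-cong-≗ (λ x → cong (_· 1) (e x))

    card-mono : (p q : Fin n → Bool) → (∀ x → p x ≡ true → q x ≡ true) → card p ≤ card q
    card-mono p q h = sum-mono-≤ (λ x → ·1-mono (h x))

    card-∨ : (p q : Fin n → Bool) → (∀ x → (p x ∧ q x) ≡ false) → card (λ x → p x ∨ q x) ≡ card p + card q
    card-∨ p q h = trans (sum-cong-≗ (λ x → ·1-∨ (p x) (q x) (h x))) (∑-distrib-+ (λ x → p x · 1) (λ x → q x · 1))

    card-∨≤ : (p q : Fin n → Bool) → card (λ x → p x ∨ q x) ≤ card p + card q
    card-∨≤ p q = subst (card (λ x → p x ∨ q x) ≤_) (∑-distrib-+ (λ x → p x · 1) (λ x → q x · 1))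
                        (sum-mono-≤ (λ x → ·1-∨≤ (p x) (q x)))

    sum-·-card : (p : Fin n → Bool) (k : ℕ) → sum (λ x → p x · k) ≡ card p * k
    sum-·-card p k = begin
      sum (λ x → p x · k)        ≡⟨ sum-cong-≗ (λ x → trans (·-as-* (p x) k) (*-comm (p x · 1) k)) ⟩
      sum (λ x → k * (p x · 1))  ≡⟨ sym (*-distribˡ-sum k (λ x → p x · 1)) ⟩
      k * card p                 ≡⟨ *-comm k (card p) ⟩
      card p * k                 ∎
      where open ≡-Reasoning

  card-true : ∀ {n} → card {n} (λ _ → true) ≡ n
  card-true {zero}  = refl
  card-true {suc n} = cong suc (card-true {n})

  module _ {n : ℕ} where

    card-≤ : (p : Fin n → Bool) → card p ≤ n
    card-≤ p = subst (card p ≤_) card-true (card-mono p (λ _ → true) (λ _ _ → refl))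

    card-+-card-not : (p : Fin n → Bool) → card p + card (λ x → not (p x)) ≡ n
    card-+-card-not p = trans (sym (∑-distrib-+ (λ x → p x · 1) (λ x → not (p x) · 1)))
                              (trans (sum-cong-≗ (λ x → ·1-not (p x))) card-true)

    card-≡ : (a : Fin n) → card (_==ᶠ a) ≡ 1
    card-≡ a = trans (sum-single a _ (λ z z≢a → cong (_· 1) (≢⇒==ᶠ-false z≢a))) (cong (_· 1) (==ᶠ-refl a))

    card-pair : (a b : Fin n) → a ≢ b → card (λ z → (z ==ᶠ a) ∨ (z ==ᶠ b)) ≡ 2
    card-pair a b a≢b = trans (card-∨ _ _ disjoint) (cong₂ _+_ (card-≡ a) (card-≡ b))
      where
      disjoint : ∀ z → ((z ==ᶠ a) ∧ (z ==ᶠ b)) ≡ false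
      disjoint z with z ≟ᶠ a
      ... | yes refl = ≢⇒==ᶠ-false a≢b
      ... | no _     = refl

    card-complement : (p : Fin n → Bool) {k : ℕ} → card p ≡ k → card (λ x → not (p x)) ≡ n ∸ k
    card-complement p {k} refl = trans (sym (m+n∸m≡n (card p) _)) (cong (_∸ card p) (card-+-card-not p))

    card-≢ : (a : Fin n) → card (λ z → not (z ==ᶠ a)) ≡ n ∸ 1
    card-≢ a = card-complement (_==ᶠ a) (card-≡ a)

    card-≢≢ : (a b : Fin n) → a ≢ b → card (λ z → not (z ==ᶠ a) ∧ not (z ==ᶠ b)) ≡ n ∸ 2
    card-≢≢ a b a≢b = trans (card-cong (λ z → deMorgan (z ==ᶠ a) (z ==ᶠ b)))
                            (card-complement (λ z → (z ==ᶠ a) ∨ (z ==ᶠ b)) (card-pair a b a≢b))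
      where
      deMorgan : ∀ s t → (not s ∧ not t) ≡ not (s ∨ t)
      deMorgan false t = refl
      deMorgan true  t = refl

  card≡0⇒ : ∀ {n} (p : Fin n → Bool) → card p ≡ 0 → ∀ z → p z ≡ false
  card≡0⇒ {suc n} p e z with p zero in eq
  card≡0⇒ {suc n} p e zero    | false = eq
  card≡0⇒ {suc n} p e (suc z) | false = card≡0⇒ (λ x → p (suc x)) e z

  card≡1⇒ : ∀ {n} (p : Fin n → Bool) → card p ≡ 1 → Σ[ a ∈ Fin n ] (∀ z → p z ≡ (z ==ᶠ a))
  card≡1⇒ {suc n} p e with p zero in eq
  ... | true = zero , at
    where
    at : ∀ z → p z ≡ (z ==ᶠ zero)
    at zero    = eq
    at (suc z) = card≡0⇒ (λ x → p (suc x)) (cong pred e) z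
  ... | false with a , at ← card≡1⇒ (λ x → p (suc x)) e = suc a , at′
    where
    at′ : ∀ z → p z ≡ (z ==ᶠ suc a)
    at′ zero    = eq
    at′ (suc z) = trans (at z) (sym (==ᶠ-suc z a))

  card≡2⇒ : ∀ {n} (p : Fin n → Bool) → card p ≡ 2 →
            Σ[ a ∈ Fin n ] Σ[ b ∈ Fin n ] (a ≢ b × (∀ z → p z ≡ ((z ==ᶠ a) ∨ (z ==ᶠ b))))
  card≡2⇒ {suc n} p e with p zero in eq
  ... | true with b , at ← card≡1⇒ (λ x → p (suc x)) (cong pred e) = zero , suc b , (λ ()) , at′
    where
    at′ : ∀ z → p z ≡ ((z ==ᶠ zero) ∨ (z ==ᶠ suc b))
    at′ zero    = eq
    at′ (suc z) = trans (at z) (sym (==ᶠ-suc z b))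
  ... | false with a , b , a≢b , at ← card≡2⇒ (λ x → p (suc x)) e =
    suc a , suc b , (λ q → a≢b (suc-injective q)) , at′
    where
    at′ : ∀ z → p z ≡ ((z ==ᶠ suc a) ∨ (z ==ᶠ suc b))
    at′ zero    = eq
    at′ (suc z) = trans (at z) (sym (cong₂ _∨_ (==ᶠ-suc z a) (==ᶠ-suc z b)))

  private
    sum-∧ : ∀ {n} b (q : Fin n → Bool) → sum (λ y → (b ∧ q y) · 1) ≡ b · card q
    sum-∧ {n} false q = sum-replicate-zero n
    sum-∧     true  q = refl

    sumPairs-∧ : ∀ {n} b (q : Fin n → Fin n → Bool) →
                 sumPairs (λ y z → (b ∧ q y z) · 1) ≡ b · sumPairs (λ y z → q y z · 1)
    sumPairs-∧ {n} false q = sumPairs-zero {n}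
    sumPairs-∧     true  q = refl

    pascal : ∀ b c k → (b · 1 + c) C suc k ≡ b · (c C k) + c C suc k
    pascal false c k = refl
    pascal true  c k = sym (nCk+nC[k+1]≡[n+1]C[k+1] c k)

  sumPairs-C2 : ∀ {n} (p : Fin n → Bool) → sumPairs (λ x y → (p x ∧ p y) · 1) ≡ card p C 2
  sumPairs-C2 {zero}  p = refl
  sumPairs-C2 {suc n} p = begin
    sum (λ y → (p zero ∧ p (suc y)) · 1) + sumPairs (λ x y → (p′ x ∧ p′ y) · 1)
      ≡⟨ cong₂ _+_ (sum-∧ (p zero) p′) (sumPairs-C2 p′) ⟩
    p zero · card p′ + card p′ C 2
      ≡⟨ cong (λ t → p zero · t + card p′ C 2) (sym (nC1≡n (card p′))) ⟩
    p zero · (card p′ C 1) + card p′ C 2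
      ≡⟨ sym (pascal (p zero) (card p′) 1) ⟩
    card p C 2 ∎
    where
    open ≡-Reasoning
    p′ = λ x → p (suc x)

  sumTriples-C3 : ∀ {n} (p : Fin n → Bool) → sumTriples (λ x y z → (p x ∧ p y ∧ p z) · 1) ≡ card p C 3
  sumTriples-C3 {zero}  p = refl
  sumTriples-C3 {suc n} p = begin
    sumPairs (λ y z → (p zero ∧ p′ y ∧ p′ z) · 1) + sumTriples (λ x y z → (p′ x ∧ p′ y ∧ p′ z) · 1)
      ≡⟨ cong₂ _+_ (trans (sumPairs-∧ (p zero) (λ y z → p′ y ∧ p′ z)) (cong (p zero ·_) (sumPairs-C2 p′)))
                   (sumTriples-C3 p′) ⟩
    p zero · (card p′ C 2) + card p′ C 3
      ≡⟨ sym (pascal (p zero) (card p′) 2) ⟩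
    card p C 3 ∎
    where
    open ≡-Reasoning
    p′ = λ x → p (suc x)

  sumPairs-cross : ∀ {n} (p q : Fin n → Bool) → (∀ x → (p x ∧ q x) ≡ false) →
                   sumPairs (λ x y → ((p x ∧ q y) ∨ (q x ∧ p y)) · 1) ≡ card p * card q
  sumPairs-cross {zero}  p q disjoint = refl
  sumPairs-cross {suc n} p q disjoint with p zero in p₀ | q zero in q₀ | sumPairs-cross p′ q′ (λ x → disjoint (suc x))
    where
    p′ = λ x → p (suc x)
    q′ = λ x → q (suc x)
  ... | true  | true  | _  with () ← trans (sym (disjoint zero)) (cong₂ _∧_ p₀ q₀)
  ... | true  | false | ih = cong₂ _+_ (sum-cong-≗ (λ y → cong (_· 1) (∨-identityʳ (q (suc y))))) ih
  ... | false | true  | ih = trans (cong (_+_ (card (λ x → p (suc x)))) ih) (sym (*-suc (card (λ x → p (suc x))) _))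
  ... | false | false | ih = cong₂ _+_ (sum-replicate-zero n) ih

  sumPairs-ordered : ∀ {n} (f : Fin n → Fin n → ℕ) →
                     sumPairs (λ x y → f x y + f y x) ≡ sum (λ x → sum (λ y → not (y ==ᶠ x) · f x y))
  sumPairs-ordered {zero}  f = refl
  sumPairs-ordered {suc n} f = begin
    sum (λ y → f zero (suc y) + f (suc y) zero) + sumPairs (λ x y → f′ x y + f′ y x)
      ≡⟨ cong₂ _+_ (∑-distrib-+ (λ y → f zero (suc y)) (λ y → f (suc y) zero)) (sumPairs-ordered f′) ⟩
    (A + B) + D
      ≡⟨ +-assoc A B D ⟩
    A + (B + D)
      ≡⟨ cong (_+_ A) (sym (∑-distrib-+ (λ x → f (suc x) zero) (λ x → sum (λ y → not (y ==ᶠ x) · f′ x y)))) ⟩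
    A + sum (λ x → f (suc x) zero + sum (λ y → not (y ==ᶠ x) · f′ x y))
      ≡⟨ cong (_+_ A) (sum-cong-≗ (λ x → cong (_+_ (f (suc x) zero))
           (sum-cong-≗ (λ y → cong (λ b → not b · f′ x y) (sym (==ᶠ-suc y x)))))) ⟩
    sum (λ x → sum (λ y → not (y ==ᶠ x) · f x y)) ∎
    where
    open ≡-Reasoning
    f′ = λ x y → f (suc x) (suc y)
    A = sum (λ y → f zero (suc y))
    B = sum (λ x → f (suc x) zero)
    D = sum (λ x → sum (λ y → not (y ==ᶠ x) · f′ x y))

  -- Every triple {u < v < w} is counted once for each choice of apex x ∈ {u, v, w}.
  sumTriples-by-apex : ∀ {n} (F : Fin n → Fin n → Fin n → ℕ) →
    sumTriples (λ u v w → F u v w + F v u w + F w u v) ≡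
    sum (λ x → sumPairs (λ y z → (not (y ==ᶠ x) ∧ not (z ==ᶠ x)) · F x y z))
  sumTriples-by-apex {zero}  F = refl
  sumTriples-by-apex {suc n} F = begin
    sumPairs (λ v w → F zero (suc v) (suc w) + F (suc v) zero (suc w) + F (suc w) zero (suc v))
      + sumTriples (λ u v w → F′ u v w + F′ v u w + F′ w u v)
      ≡⟨ cong₂ _+_ (begin
           sumPairs (λ v w → F zero (suc v) (suc w) + F (suc v) zero (suc w) + F (suc w) zero (suc v))
             ≡⟨ sumPairs-cong (λ v w → +-assoc (F zero (suc v) (suc w)) (F (suc v) zero (suc w)) _) ⟩
           sumPairs (λ v w → F zero (suc v) (suc w) + (F (suc v) zero (suc w) + F (suc w) zero (suc v)))
             ≡⟨ sumPairs-+ (λ v w → F zero (suc v) (suc w)) _ ⟩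
           A + sumPairs (λ v w → F (suc v) zero (suc w) + F (suc w) zero (suc v))
             ≡⟨ cong (_+_ A) (sumPairs-ordered (λ v w → F (suc v) zero (suc w))) ⟩
           A + B ∎)
         (sumTriples-by-apex F′) ⟩
    (A + B) + D
      ≡⟨ +-assoc A B D ⟩
    A + (B + D)
      ≡⟨ cong₂ _+_ (sym (cong (_+ A) (sum-replicate-zero n)))
                   (sym (∑-distrib-+ (λ x → sum (λ y → not (y ==ᶠ x) · F (suc x) zero (suc y)))
                                     (λ x → sumPairs (λ y z → (not (y ==ᶠ x) ∧ not (z ==ᶠ x)) · F′ x y z)))) ⟩
    -- the summand x = 0 is Σ_y 0 + A: the pairs y, z ≠ 0 are the pairs of successors
    (sum {n} (λ _ → 0) + A) + sum (λ x → sum (λ y → not (y ==ᶠ x) · F (suc x) zero (suc y))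
                                        + sumPairs (λ y z → (not (y ==ᶠ x) ∧ not (z ==ᶠ x)) · F′ x y z))
      ≡⟨ cong (_+_ (sum {n} (λ _ → 0) + A)) (sum-cong-≗ (λ x → cong₂ _+_
           (sum-cong-≗ (λ y → cong (λ b → not b · F (suc x) zero (suc y)) (sym (==ᶠ-suc y x))))
           (sumPairs-cong (λ y z → cong₂ (λ b c → (not b ∧ not c) · F′ x y z) (sym (==ᶠ-suc y x)) (sym (==ᶠ-suc z x)))))) ⟩
    sum (λ x → sumPairs (λ y z → (not (y ==ᶠ x) ∧ not (z ==ᶠ x)) · F x y z)) ∎
    where
    open ≡-Reasoning
    F′ = λ x y z → F (suc x) (suc y) (suc z)
    A = sumPairs (λ v w → F zero (suc v) (suc w))
    B = sum (λ x → sum (λ y → not (y ==ᶠ x) · F (suc x) zero (suc y)))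
    D = sum (λ x → sumPairs (λ y z → (not (y ==ᶠ x) ∧ not (z ==ᶠ x)) · F′ x y z))

  -- Every triple {u < v < w} is counted once for each choice of a pair {x < y} ⊂ {u, v, w}.
  sumTriples-by-pair : ∀ {n} (g : Fin n → Fin n → Fin n → ℕ) →
    sumTriples (λ u v w → g u v w + g u w v + g v w u) ≡
    sumPairs (λ x y → sum (λ z → (not (z ==ᶠ x) ∧ not (z ==ᶠ y)) · g x y z))
  sumTriples-by-pair {zero}  g = refl
  sumTriples-by-pair {suc n} g = begin
    sumPairs (λ v w → g zero (suc v) (suc w) + g zero (suc w) (suc v) + g (suc v) (suc w) zero)
      + sumTriples (λ u v w → g′ u v w + g′ u w v + g′ v w u)
      ≡⟨ cong₂ _+_ (trans (sumPairs-+ (λ v w → g zero (suc v) (suc w) + g zero (suc w) (suc v)) (λ v w → g (suc v) (suc w) zero))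
                          (cong (_+ B) (sumPairs-ordered (λ v w → g zero (suc v) (suc w)))))
                   (sumTriples-by-pair g′) ⟩
    (A + B) + D
      ≡⟨ +-assoc A B D ⟩
    A + (B + D)
      ≡⟨ cong₂ _+_ (sum-cong-≗ (λ y → sum-cong-≗ (λ z → cong (λ b → not b · g zero (suc y) (suc z)) (sym (==ᶠ-suc z y)))))
                   (sym (sumPairs-+ (λ x y → g (suc x) (suc y) zero)
                                    (λ x y → sum (λ z → (not (z ==ᶠ x) ∧ not (z ==ᶠ y)) · g′ x y z)))) ⟩
    sum (λ y → sum (λ z → not (Fin.suc z ==ᶠ suc y) · g zero (suc y) (suc z)))
      + sumPairs (λ x y → g (suc x) (suc y) zero + sum (λ z → (not (z ==ᶠ x) ∧ not (z ==ᶠ y)) · g′ x y z))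
      ≡⟨ cong (_+_ A′) (sumPairs-cong (λ x y → cong (_+_ (g (suc x) (suc y) zero)) (sum-cong-≗ (λ z →
           cong₂ (λ b c → (not b ∧ not c) · g′ x y z) (sym (==ᶠ-suc z x)) (sym (==ᶠ-suc z y)))))) ⟩
    sumPairs (λ x y → sum (λ z → (not (z ==ᶠ x) ∧ not (z ==ᶠ y)) · g x y z)) ∎
    where
    open ≡-Reasoning
    g′ = λ x y z → g (suc x) (suc y) (suc z)
    A = sum (λ x → sum (λ y → not (y ==ᶠ x) · g zero (suc x) (suc y)))
    A′ = sum (λ y → sum (λ z → not (Fin.suc z ==ᶠ suc y) · g zero (suc y) (suc z)))
    B = sumPairs (λ v w → g (suc v) (suc w) zero)
    D = sumPairs (λ x y → sum (λ z → (not (z ==ᶠ x) ∧ not (z ==ᶠ y)) · g′ x y z))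

  sumPairs-·-card : ∀ {n} (p : Fin n → Fin n → Bool) k → sumPairs (λ x y → p x y · k) ≡ sumPairs (λ x y → p x y · 1) * k
  sumPairs-·-card p k = trans (sumPairs-cong (λ x y → trans (·-as-* (p x y) k) (*-comm (p x y · 1) k)))
                              (trans (sumPairs-*ˡ k (λ x y → p x y · 1)) (*-comm k _))

  sumTriples-vertex-and-pair : ∀ {n} (f : Fin n → Bool) (g : Fin n → Fin n → Bool) →
    (∀ x y → f x ≡ true → g x y ≡ false) → (∀ x y → f x ≡ true → g y x ≡ false) →
    sumTriples (λ u v w → ((f u ∧ g v w) ∨ (f v ∧ g u w) ∨ (f w ∧ g u v)) · 1) ≡ card f * sumPairs (λ y z → g y z · 1)
  sumTriples-vertex-and-pair {n} f g g₁ g₂ = begin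
    sumTriples (λ u v w → ((f u ∧ g v w) ∨ (f v ∧ g u w) ∨ (f w ∧ g u v)) · 1)
      ≡⟨ sumTriples-cong (λ u v w → ·1-∨₃ (f u ∧ g v w) (f v ∧ g u w) (f w ∧ g u v)
                                           (exclusive u (g₁ u w)) (exclusive u (g₁ u v)) (exclusive v (g₂ v u))) ⟩
    sumTriples (λ u v w → (f u ∧ g v w) · 1 + (f v ∧ g u w) · 1 + (f w ∧ g u v) · 1)
      ≡⟨ sumTriples-by-apex (λ x y z → (f x ∧ g y z) · 1) ⟩
    sum (λ x → sumPairs (λ y z → (not (y ==ᶠ x) ∧ not (z ==ᶠ x)) · ((f x ∧ g y z) · 1)))
      ≡⟨ sum-cong-≗ apex ⟩
    sum (λ x → f x · P)
      ≡⟨ sum-·-card f P ⟩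
    card f * P ∎
    where
    open ≡-Reasoning
    P = sumPairs (λ y z → g y z · 1)
    exclusive : ∀ a {s t r} → (f a ≡ true → s ≡ false) → ((f a ∧ r) ∧ (t ∧ s)) ≡ false
    exclusive a {s} {t} {r} h with f a
    ... | false = refl
    ... | true rewrite h refl with r | t
    ...   | false | _ = refl
    ...   | true  | false = refl
    ...   | true  | true  = refl
    apex : ∀ x → sumPairs (λ y z → (not (y ==ᶠ x) ∧ not (z ==ᶠ x)) · ((f x ∧ g y z) · 1)) ≡ f x · P
    apex x with f x in fx
    ... | false = trans (sumPairs-cong (λ y z → ·-zeroʳ (not (y ==ᶠ x) ∧ not (z ==ᶠ x)))) (sumPairs-zero {n})
    ... | true  = sumPairs-cong pointwise
      where
      pointwise : ∀ y z → (not (y ==ᶠ x) ∧ not (z ==ᶠ x)) · (g y z · 1) ≡ g y z · 1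
      pointwise y z with g y z in gyz
      ... | false = ·-zeroʳ (not (y ==ᶠ x) ∧ not (z ==ᶠ x))
      ... | true with y ≟ᶠ x | z ≟ᶠ x
      ...   | yes refl | _        with () ← trans (sym gyz) (g₁ y z fx)
      ...   | no _     | yes refl with () ← trans (sym gyz) (g₂ z y fx)
      ...   | no _     | no _     = refl

  count-∷ : ∀ {a} {A : Set a} (p : A → Bool) x xs → count p (x ∷ xs) ≡ p x · 1 + count p xs
  count-∷ p x xs with p x
  ... | true  = refl
  ... | false = refl

  count-cong : ∀ {a} {A : Set a} {p q : A → Bool} (xs : List A) → (∀ x → p x ≡ q x) → count p xs ≡ count q xs
  count-cong []       e = refl
  count-cong {p = p} {q} (x ∷ xs) e =
    trans (count-∷ p x xs) (trans (cong₂ _+_ (cong (_· 1) (e x)) (count-cong xs e)) (sym (count-∷ q x xs)))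

  count-++ : ∀ {a} {A : Set a} (p : A → Bool) (xs ys : List A) → count p (xs ++ ys) ≡ count p xs + count p ys
  count-++ p []       ys = refl
  count-++ p (x ∷ xs) ys =
    trans (count-∷ p x (xs ++ ys))
          (trans (cong (_+_ (p x · 1)) (count-++ p xs ys))
                 (trans (sym (+-assoc (p x · 1) _ _)) (cong (_+ count p ys) (sym (count-∷ p x xs)))))

  count-map : ∀ {a b} {A : Set a} {B : Set b} (p : B → Bool) (f : A → B) (xs : List A) →
              count p (map f xs) ≡ count (λ x → p (f x)) xs
  count-map p f []       = refl
  count-map p f (x ∷ xs) = trans (count-∷ p (f x) (map f xs))
                                 (trans (cong (_+_ (p (f x) · 1)) (count-map p f xs)) (sym (count-∷ (λ x → p (f x)) x xs)))

  count-false : ∀ {a} {A : Set a} (xs : List A) → count (λ _ → false) xs ≡ 0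
  count-false []       = refl
  count-false (x ∷ xs) = count-false xs

  count-tabulate : ∀ {n a} {A : Set a} (p : A → Bool) (f : Fin n → A) → count p (tabulate f) ≡ sum (λ x → p (f x) · 1)
  count-tabulate {zero}  p f = refl
  count-tabulate {suc n} p f = trans (count-∷ p (f zero) (tabulate (λ x → f (suc x))))
                                     (cong (_+_ (p (f zero) · 1)) (count-tabulate p (λ x → f (suc x))))

  count-allFin : ∀ {n} (p : Fin n → Bool) → count p (allFin n) ≡ card p
  count-allFin p = count-tabulate p (λ x → x)

  count-concatMap : ∀ {a} {A : Set a} (p : A → Bool) {k m} (h : Fin k → Fin m) (g : Fin m → List A) →
                    count p (concatMap g (tabulate h)) ≡ sum (λ i → count p (g (h i)))
  count-concatMap p {zero}  h g = refl
  count-concatMap p {suc k} h g = trans (count-++ p (g (h zero)) _)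
                                        (cong (_+_ (count p (g (h zero)))) (count-concatMap p (λ i → h (suc i)) g))

  inPair : ∀ {n} → Fin n → Fin n → Fin n → Bool
  inPair u v y = (y ==ᶠ u) ∨ (y ==ᶠ v)

  inTriple : ∀ {n} → Fin n → Fin n → Fin n → Fin n → Bool
  inTriple u v w y = (y ==ᶠ u) ∨ (y ==ᶠ v) ∨ (y ==ᶠ w)

  singleton : ∀ {n} → Fin n → Subset n
  singleton u = tabulateᵛ (_==ᶠ u)

  pairSet : ∀ {n} → Fin n → Fin n → Subset n
  pairSet u v = tabulateᵛ (inPair u v)

  tripleSet : ∀ {n} → Fin n → Fin n → Fin n → Subset n
  tripleSet u v w = tabulateᵛ (inTriple u v w)

  ∣∣≡card : ∀ {n} (S : Subset n) → ∣ S ∣ ≡ card (lookup S)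
  ∣∣≡card []          = refl
  ∣∣≡card (true ∷ S)  = cong suc (∣∣≡card S)
  ∣∣≡card (false ∷ S) = ∣∣≡card S

  count-allSubsets-suc : ∀ {n} (p : Subset (suc n) → Bool) →
    count p (allSubsets (suc n)) ≡ count (λ S → p (true ∷ S)) (allSubsets n) + count (λ S → p (false ∷ S)) (allSubsets n)
  count-allSubsets-suc {n} p =
    trans (count-++ p (map (true ∷_) (allSubsets n)) (map (false ∷_) (allSubsets n)))
          (cong₂ _+_ (count-map p (true ∷_) (allSubsets n)) (count-map p (false ∷_) (allSubsets n)))

  count-size≡0 : ∀ {n} (P : Subset n → Bool) →
    count (λ S → (∣ S ∣ ≡ᵇ 0) ∧ P S) (allSubsets n) ≡ P (tabulateᵛ (λ _ → false)) · 1
  count-size≡0 {zero}  P = trans (count-∷ (λ S → (∣ S ∣ ≡ᵇ 0) ∧ P S) [] []) (+-identityʳ (P [] · 1))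
  count-size≡0 {suc n} P = trans (count-allSubsets-suc (λ S → (∣ S ∣ ≡ᵇ 0) ∧ P S))
                                 (cong₂ _+_ (count-false (allSubsets n)) (count-size≡0 (λ S → P (false ∷ S))))

  count-size≡1 : ∀ {n} (P : Subset n → Bool) →
    count (λ S → (∣ S ∣ ≡ᵇ 1) ∧ P S) (allSubsets n) ≡ sum (λ u → P (singleton u) · 1)
  count-size≡1 {zero}  P = refl
  count-size≡1 {suc n} P = trans (count-allSubsets-suc (λ S → (∣ S ∣ ≡ᵇ 1) ∧ P S))
    (cong₂ _+_ (count-size≡0 (λ S → P (true ∷ S)))
               (trans (count-size≡1 (λ S → P (false ∷ S)))
                      (sum-cong-≗ (λ u → cong (λ S → P (false ∷ S) · 1) (tabulate-cong (λ y → sym (==ᶠ-suc y u)))))))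

  count-size≡2 : ∀ {n} (P : Subset n → Bool) →
    count (λ S → (∣ S ∣ ≡ᵇ 2) ∧ P S) (allSubsets n) ≡ sumPairs (λ u v → P (pairSet u v) · 1)
  count-size≡2 {zero}  P = refl
  count-size≡2 {suc n} P = trans (count-allSubsets-suc (λ S → (∣ S ∣ ≡ᵇ 2) ∧ P S))
    (cong₂ _+_ (trans (count-size≡1 (λ S → P (true ∷ S)))
                      (sum-cong-≗ (λ v → cong (λ S → P (true ∷ S) · 1) (tabulate-cong (λ y → sym (==ᶠ-suc y v))))))
               (trans (count-size≡2 (λ S → P (false ∷ S)))
                      (sumPairs-cong (λ u v → cong (λ S → P (false ∷ S) · 1)
                        (tabulate-cong (λ y → sym (cong₂ _∨_ (==ᶠ-suc y u) (==ᶠ-suc y v))))))))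

  count-size≡3 : ∀ {n} (P : Subset n → Bool) →
    count (λ S → (∣ S ∣ ≡ᵇ 3) ∧ P S) (allSubsets n) ≡ sumTriples (λ u v w → P (tripleSet u v w) · 1)
  count-size≡3 {zero}  P = refl
  count-size≡3 {suc n} P = trans (count-allSubsets-suc (λ S → (∣ S ∣ ≡ᵇ 3) ∧ P S))
    (cong₂ _+_ (trans (count-size≡2 (λ S → P (true ∷ S)))
                      (sumPairs-cong (λ v w → cong (λ S → P (true ∷ S) · 1)
                        (tabulate-cong (λ y → sym (cong₂ _∨_ (==ᶠ-suc y v) (==ᶠ-suc y w)))))))
               (trans (count-size≡3 (λ S → P (false ∷ S)))
                      (sumTriples-cong (λ u v w → cong (λ S → P (false ∷ S) · 1)
                        (tabulate-cong (λ y → sym (cong₂ _∨_ (==ᶠ-suc y u) (cong₂ _∨_ (==ᶠ-suc y v) (==ᶠ-suc y w)))))))))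

  count-allSubsets-∁ : ∀ {n} (p : Subset n → Bool) → count p (allSubsets n) ≡ count (λ S → p (∁ S)) (allSubsets n)
  count-allSubsets-∁ {zero}  p = trans (count-∷ p [] []) (sym (count-∷ (λ S → p (∁ S)) [] []))
  count-allSubsets-∁ {suc n} p = trans (count-allSubsets-suc p)
    (trans (+-comm (count (λ S → p (true ∷ S)) (allSubsets n)) _)
    (trans (cong₂ _+_ (count-allSubsets-∁ (λ S → p (false ∷ S))) (count-allSubsets-∁ (λ S → p (true ∷ S))))
           (sym (count-allSubsets-suc (λ S → p (∁ S))))))

  module _ {n : ℕ} (G : SimpleGraph n) where

    count-allPairs : (q : Fin n × Fin n → Bool) → count q (allPairs G) ≡ sum (λ u → sum (λ v → q (u , v) · 1))
    count-allPairs q = trans (count-concatMap q {n} (λ i → i) (λ u → map (u ,_) (allFin n)))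
      (sum-cong-≗ (λ u → trans (count-map q (u ,_) (allFin n)) (count-allFin (λ v → q (u , v)))))

    pairCount≡sumPairs : (p : Fin n → Fin n → Bool) → pairCount G p ≡ sumPairs (λ u v → p u v · 1)
    pairCount≡sumPairs p = trans (count-allPairs _) (ordered p)
      where
      ordered : ∀ {m} (q : Fin m → Fin m → Bool) →
                sum (λ u → sum (λ v → ((toℕ u <ᵇ toℕ v) ∧ q u v) · 1)) ≡ sumPairs (λ u v → q u v · 1)
      ordered {zero}  q = refl
      ordered {suc m} q = cong (_+_ (sum (λ v → q zero (suc v) · 1))) (ordered (λ u v → q (suc u) (suc v)))

  inPair-cases : ∀ {n} (u v y : Fin n) → inPair u v y ≡ true → y ≡ u ⊎ y ≡ v
  inPair-cases u v y h with y ≟ᶠ u | y ≟ᶠ v | h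
  ... | yes y≡u | _       | _ = inj₁ y≡u
  ... | no _    | yes y≡v | _ = inj₂ y≡v
  ... | no _    | no _    | ()

  inTriple-cases : ∀ {n} (u v w y : Fin n) → inTriple u v w y ≡ true → y ≡ u ⊎ y ≡ v ⊎ y ≡ w
  inTriple-cases u v w y h with y ≟ᶠ u
  ... | yes y≡u = inj₁ y≡u
  ... | no _    = inj₂ (inPair-cases v w y h)

  module _ {n : ℕ} (u v : Fin n) where

    inPair-₁ : inPair u v u ≡ true
    inPair-₁ rewrite ==ᶠ-refl u = refl

    inPair-₂ : inPair u v v ≡ true
    inPair-₂ rewrite ==ᶠ-refl v = ∨-zeroʳ (v ==ᶠ u)

  module _ {n : ℕ} (u v w : Fin n) where

    inTriple-₁ : inTriple u v w u ≡ true
    inTriple-₁ rewrite ==ᶠ-refl u = refl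

    inTriple-₂ : inTriple u v w v ≡ true
    inTriple-₂ rewrite ==ᶠ-refl v = ∨-zeroʳ (v ==ᶠ u)

    inTriple-₃ : inTriple u v w w ≡ true
    inTriple-₃ rewrite ==ᶠ-refl w | ∨-zeroʳ (w ==ᶠ v) = ∨-zeroʳ (w ==ᶠ u)

  module _ {n : ℕ} (q : Fin n → Bool) where

    all⇒ᵇ-intro : (m : Fin n → Bool) → (∀ w → m w ≡ true → q w ≡ true) → all (λ w → m w ⇒ᵇ q w) (allFin n) ≡ true
    all⇒ᵇ-intro m h = ∀⇒all _ (λ w → ⇒ᵇ-intro (h w))

    all⇒ᵇ-elim : (m : Fin n → Bool) → all (λ w → m w ⇒ᵇ q w) (allFin n) ≡ true → ∀ w → m w ≡ true → q w ≡ true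
    all⇒ᵇ-elim m h w = ⇒ᵇ-elim (all⇒∀ _ h w)

    all-single⇒ : (a : Fin n) → all (λ w → (w ==ᶠ a) ⇒ᵇ q w) (allFin n) ≡ q a
    all-single⇒ a = ⇔→≡ (mk⇔ (λ h → all⇒ᵇ-elim (_==ᶠ a) h a (==ᶠ-refl a))
                              (λ qa → all⇒ᵇ-intro (_==ᶠ a) (λ w e → subst (λ t → q t ≡ true) (sym (==ᶠ⇒≡ e)) qa)))

    all-pair⇒ : (a b : Fin n) → all (λ w → inPair a b w ⇒ᵇ q w) (allFin n) ≡ (q a ∧ q b)
    all-pair⇒ a b = ⇔→≡ (mk⇔ (λ h → ∧-intro (all⇒ᵇ-elim (inPair a b) h a (inPair-₁ a b))
                                            (all⇒ᵇ-elim (inPair a b) h b (inPair-₂ a b)))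
                              (λ h → all⇒ᵇ-intro (inPair a b) (λ w m → case (inPair-cases a b w m) h)))
      where
      case : ∀ {w} → w ≡ a ⊎ w ≡ b → (q a ∧ q b) ≡ true → q w ≡ true
      case (inj₁ refl) h = ∧-conicalˡ _ _ h
      case (inj₂ refl) h = ∧-conicalʳ (q a) _ h

    all-triple⇒ : (a b c : Fin n) → all (λ w → inTriple a b c w ⇒ᵇ q w) (allFin n) ≡ (q a ∧ q b ∧ q c)
    all-triple⇒ a b c = ⇔→≡ (mk⇔ (λ h → ∧-intro (all⇒ᵇ-elim (inTriple a b c) h a (inTriple-₁ a b c))
                                     (∧-intro (all⇒ᵇ-elim (inTriple a b c) h b (inTriple-₂ a b c))
                                              (all⇒ᵇ-elim (inTriple a b c) h c (inTriple-₃ a b c))))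
                                  (λ h → all⇒ᵇ-intro (inTriple a b c) (λ w m → case (inTriple-cases a b c w m) h)))
      where
      case : ∀ {w} → w ≡ a ⊎ w ≡ b ⊎ w ≡ c → (q a ∧ q b ∧ q c) ≡ true → q w ≡ true
      case (inj₁ refl)        h = ∧-conicalˡ _ _ h
      case (inj₂ (inj₁ refl)) h = ∧-conicalˡ _ _ (∧-conicalʳ (q a) _ h)
      case (inj₂ (inj₂ refl)) h = ∧-conicalʳ (q b) _ (∧-conicalʳ (q a) _ h)

  module _ {n : ℕ} (u v w y : Fin n) where

    inTriple-swap₁₂ : inTriple v u w y ≡ inTriple u v w y
    inTriple-swap₁₂ = ∨-swapˡ (y ==ᶠ v) (y ==ᶠ u) (y ==ᶠ w)

    inTriple-swap₂₃ : inTriple u w v y ≡ inTriple u v w y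
    inTriple-swap₂₃ = cong ((y ==ᶠ u) ∨_) (∨-comm (y ==ᶠ w) (y ==ᶠ v))

    inTriple-rotate : inTriple w u v y ≡ inTriple u v w y
    inTriple-rotate = trans (∨-swapˡ (y ==ᶠ w) (y ==ᶠ u) (y ==ᶠ v)) (cong ((y ==ᶠ u) ∨_) (∨-comm (y ==ᶠ w) (y ==ᶠ v)))

  card-inTriple : ∀ {n} (a b c : Fin n) → a ≢ b → a ≢ c → b ≢ c → card (inTriple a b c) ≡ 3
  card-inTriple a b c a≢b a≢c b≢c = trans (card-∨ _ _ disjoint) (cong₂ _+_ (card-≡ a) (card-pair b c b≢c))
    where
    disjoint : ∀ y → ((y ==ᶠ a) ∧ inPair b c y) ≡ false
    disjoint y with y ≟ᶠ a
    ... | yes refl rewrite ≢⇒==ᶠ-false a≢b | ≢⇒==ᶠ-false a≢c = refl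
    ... | no _     = refl

  distinct⇒2≤n : ∀ {n} {a b : Fin n} → a ≢ b → 2 ≤ n
  distinct⇒2≤n {a = a} {b} a≢b = subst (_≤ _) (card-pair a b a≢b) (card-≤ (inPair a b))

  distinct⇒3≤n : ∀ {n} {a b c : Fin n} → a ≢ b → a ≢ c → b ≢ c → 3 ≤ n
  distinct⇒3≤n {a = a} {b} {c} a≢b a≢c b≢c = subst (_≤ _) (card-inTriple a b c a≢b a≢c b≢c) (card-≤ (inTriple a b c))

  -- Trapped vertices and dominating complements of triples

  module _ {n : ℕ} (G : SimpleGraph n) where

    nbhd⊆ : Fin n → (Fin n → Bool) → Bool
    nbhd⊆ x m = all (λ y → adj G x y ⇒ᵇ m y) (allFin n)

    -- x is trapped by the triple {x, a, b}: the complement of {x, a, b} does not dominate x.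
    trapped : Fin n → Fin n → Fin n → Bool
    trapped x a b = nbhd⊆ x (inPair a b)

    trapped-sym : ∀ x a b → trapped x a b ≡ trapped x b a
    trapped-sym x a b = all-cong (λ y → cong (adj G x y ⇒ᵇ_) (∨-comm (y ==ᶠ a) (y ==ᶠ b)))

    isDominating-∁ : (m : Fin n → Bool) →
                     isDominating G (∁ (tabulateᵛ m)) ≡ all (λ z → m z ⇒ᵇ not (nbhd⊆ z m)) (allFin n)
    isDominating-∁ m = all-cong pointwise
      where
      ∁m : ∀ z → lookup (∁ (tabulateᵛ m)) z ≡ not (m z)
      ∁m z = trans (lookup-map z not (tabulateᵛ m)) (cong not (lookup∘tabulate m z))
      dominator : ∀ z y → (lookup (∁ (tabulateᵛ m)) y ∧ adj G y z) ≡ not (adj G z y ⇒ᵇ m y)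
      dominator z y rewrite ∁m y | SimpleGraph.sym G y z with adj G z y | m y
      ... | true  | true  = refl
      ... | true  | false = refl
      ... | false | _     = ∧-zeroʳ _
      pointwise : ∀ z → (lookup (∁ (tabulateᵛ m)) z ∨ any (λ y → lookup (∁ (tabulateᵛ m)) y ∧ adj G y z) (allFin n))
                        ≡ (m z ⇒ᵇ not (nbhd⊆ z m))
      pointwise z rewrite ∁m z =
        cong (not (m z) ∨_) (trans (any-cong (dominator z)) (any-not (λ y → adj G z y ⇒ᵇ m y) (allFin n)))

    nbhd⊆-inTriple : ∀ u v w → nbhd⊆ u (inTriple u v w) ≡ trapped u v w
    nbhd⊆-inTriple u v w = all-cong pointwise
      where
      pointwise : ∀ y → (adj G u y ⇒ᵇ inTriple u v w y) ≡ (adj G u y ⇒ᵇ inPair v w y)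
      pointwise y with y ≟ᶠ u
      ... | yes refl rewrite SimpleGraph.irrefl G y = refl
      ... | no _     = refl

    isDominating-∁-tripleSet : ∀ u v w →
      isDominating G (∁ (tripleSet u v w)) ≡ (not (trapped u v w) ∧ not (trapped v u w) ∧ not (trapped w u v))
    isDominating-∁-tripleSet u v w = begin
      isDominating G (∁ (tripleSet u v w))
        ≡⟨ isDominating-∁ (inTriple u v w) ⟩
      all (λ z → inTriple u v w z ⇒ᵇ not (nbhd⊆ z (inTriple u v w))) (allFin n)
        ≡⟨ all-triple⇒ (λ z → not (nbhd⊆ z (inTriple u v w))) u v w ⟩
      not (nbhd⊆ u (inTriple u v w)) ∧ not (nbhd⊆ v (inTriple u v w)) ∧ not (nbhd⊆ w (inTriple u v w))
        ≡⟨ cong₂ (λ s t → not (nbhd⊆ u (inTriple u v w)) ∧ not s ∧ not t)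
                 (all-cong (λ y → cong (adj G v y ⇒ᵇ_) (sym (inTriple-swap₁₂ u v w y))))
                 (all-cong (λ y → cong (adj G w y ⇒ᵇ_) (sym (inTriple-rotate u v w y)))) ⟩
      not (nbhd⊆ u (inTriple u v w)) ∧ not (nbhd⊆ v (inTriple v u w)) ∧ not (nbhd⊆ w (inTriple w u v))
        ≡⟨ cong₂ (λ s t → not s ∧ t) (nbhd⊆-inTriple u v w)
                 (cong₂ (λ s t → not s ∧ not t) (nbhd⊆-inTriple v u w) (nbhd⊆-inTriple w u v)) ⟩
      not (trapped u v w) ∧ not (trapped v u w) ∧ not (trapped w u v) ∎
      where open ≡-Reasoning

  private
    size-complement : ∀ m a → a ≤ 3 + m → ⌊ + ((3 + m) ∸ a) ≟ℤ + m ⌋ ≡ (a ≡ᵇ 3)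
    size-complement m a a≤ = ⇔→≡ (mk⇔ to from)
      where
      to : ⌊ + ((3 + m) ∸ a) ≟ℤ + m ⌋ ≡ true → (a ≡ᵇ 3) ≡ true
      to e = ≡⇒≡ᵇ-true (+-cancelˡ-≡ m a 3 (trans (cong (_+ a) (sym rest)) (trans (m∸n+n≡m a≤) (+-comm 3 m))))
        where
        rest : (3 + m) ∸ a ≡ m
        rest = +-injective (toWitness (subst T (sym e) _))
      from : (a ≡ᵇ 3) ≡ true → ⌊ + ((3 + m) ∸ a) ≟ℤ + m ⌋ ≡ true
      from e rewrite ≡ᵇ-true⇒≡ {a} {3} e = trans (isYes≗does (+ m ≟ℤ + m)) (dec-true (+ m ≟ℤ + m) refl)

  domCount≡untrappedTriples : ∀ n (G : SimpleGraph n) → domCount G (+ n - + 3) ≡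
    sumTriples (λ u v w → (not (trapped G u v w) ∧ not (trapped G v u w) ∧ not (trapped G w u v)) · 1)
  domCount≡untrappedTriples 0 G = trans (count-cong (allSubsets 0) (λ S → ∧-zeroʳ (isDominating G S))) (count-false (allSubsets 0))
  domCount≡untrappedTriples 1 G = trans (count-cong (allSubsets 1) (λ S → ∧-zeroʳ (isDominating G S))) (count-false (allSubsets 1))
  domCount≡untrappedTriples 2 G = trans (count-cong (allSubsets 2) (λ S → ∧-zeroʳ (isDominating G S))) (count-false (allSubsets 2))
  domCount≡untrappedTriples n@(suc (suc (suc m))) G = begin
    count (λ S → isDominating G S ∧ ⌊ + ∣ S ∣ ≟ℤ + m ⌋) (allSubsets n)
      ≡⟨ count-allSubsets-∁ {n} _ ⟩
    count (λ S → isDominating G (∁ S) ∧ ⌊ + ∣ ∁ S ∣ ≟ℤ + m ⌋) (allSubsets n)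
      ≡⟨ count-cong (allSubsets n) size3 ⟩
    count (λ S → (∣ S ∣ ≡ᵇ 3) ∧ isDominating G (∁ S)) (allSubsets n)
      ≡⟨ count-size≡3 (λ S → isDominating G (∁ S)) ⟩
    sumTriples (λ u v w → isDominating G (∁ (tripleSet u v w)) · 1)
      ≡⟨ sumTriples-cong (λ u v w → cong (_· 1) (isDominating-∁-tripleSet G u v w)) ⟩
    sumTriples (λ u v w → (not (trapped G u v w) ∧ not (trapped G v u w) ∧ not (trapped G w u v)) · 1) ∎
    where
    open ≡-Reasoning
    size3 : ∀ S → (isDominating G (∁ S) ∧ ⌊ + ∣ ∁ S ∣ ≟ℤ + m ⌋) ≡ ((∣ S ∣ ≡ᵇ 3) ∧ isDominating G (∁ S))
    size3 S rewrite ∣∁p∣≡n∸∣p∣ S | size-complement m ∣ S ∣ (∣p∣≤n S) = ∧-comm (isDominating G (∁ S)) (∣ S ∣ ≡ᵇ 3)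

  module _ {n : ℕ} (G : SimpleGraph n) where

    degree≡card : ∀ x → degree G x ≡ card (adj G x)
    degree≡card x = count-allFin (adj G x)

    adj⇒≢ : ∀ {x a} → adj G x a ≡ true → a ≢ x
    adj⇒≢ {x} e refl with () ← trans (sym (SimpleGraph.irrefl G x)) e

    trapped-isolated : ∀ {x} → (∀ w → adj G x w ≡ false) → ∀ y z → trapped G x y z ≡ true
    trapped-isolated h y z = all⇒ᵇ-intro (inPair y z) (adj G _) (λ w e → case trans (sym (h w)) e of λ ())

    trapped-leaf : ∀ {x a} → (∀ w → adj G x w ≡ (w ==ᶠ a)) → ∀ y z → trapped G x y z ≡ inPair y z a
    trapped-leaf {a = a} h y z = trans (all-cong (λ w → cong (_⇒ᵇ inPair y z w) (h w))) (all-single⇒ (inPair y z) a)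

    trapped-deg2 : ∀ {x a b} → (∀ w → adj G x w ≡ inPair a b w) → ∀ y z → trapped G x y z ≡ (inPair y z a ∧ inPair y z b)
    trapped-deg2 {a = a} {b} h y z = trans (all-cong (λ w → cong (_⇒ᵇ inPair y z w) (h w))) (all-pair⇒ (inPair y z) a b)

    trapped⇒card≤2 : ∀ {x y z} → trapped G x y z ≡ true → card (adj G x) ≤ 2
    trapped⇒card≤2 {x} {y} {z} h =
      ≤-trans (card-mono (adj G x) (inPair y z) (all⇒ᵇ-elim (inPair y z) (adj G x) h))
              (subst (card (inPair y z) ≤_) (cong₂ _+_ (card-≡ y) (card-≡ z)) (card-∨≤ (_==ᶠ y) (_==ᶠ z)))

    trapped-deg≥3 : ∀ {x} k → card (adj G x) ≡ 3 + k → ∀ y z → trapped G x y z ≡ false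
    trapped-deg≥3 {x} k e y z with trapped G x y z in t
    ... | false = refl
    ... | true with s≤s (s≤s ()) ← subst (_≤ 2) e (trapped⇒card≤2 t)

    trapPairs : Fin n → ℕ
    trapPairs x = sumPairs (λ y z → (not (y ==ᶠ x) ∧ not (z ==ᶠ x)) · (trapped G x y z · 1))

    trapPairs-isolated : ∀ x → card (adj G x) ≡ 0 → trapPairs x ≡ (n ∸ 1) C 2
    trapPairs-isolated x e = begin
      trapPairs x
        ≡⟨ sumPairs-cong (λ y z → cong (λ t → (not (y ==ᶠ x) ∧ not (z ==ᶠ x)) · (t · 1))
                                       (trapped-isolated (card≡0⇒ (adj G x) e) y z)) ⟩
      sumPairs (λ y z → (not (y ==ᶠ x) ∧ not (z ==ᶠ x)) · 1)
        ≡⟨ sumPairs-C2 (λ y → not (y ==ᶠ x)) ⟩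
      card (λ y → not (y ==ᶠ x)) C 2
        ≡⟨ cong (_C 2) (card-≢ x) ⟩
      (n ∸ 1) C 2 ∎
      where open ≡-Reasoning

    trapPairs-leaf : ∀ x → card (adj G x) ≡ 1 → trapPairs x ≡ n ∸ 2
    trapPairs-leaf x e with a , at ← card≡1⇒ (adj G x) e = begin
      trapPairs x
        ≡⟨ sumPairs-cong≢ (λ y z y≢z → trans (cong (λ t → (not (y ==ᶠ x) ∧ not (z ==ᶠ x)) · (t · 1)) (trapped-leaf at y z))
                                             (split y z y≢z)) ⟩
      sumPairs (λ y z → f y z + f z y)
        ≡⟨ sumPairs-ordered f ⟩
      sum (λ y → sum (λ z → not (z ==ᶠ y) · f y z))
        ≡⟨ sum-single a _ (λ y y≢a → sum-zero _ (λ z → trans (cong (λ t → not (z ==ᶠ y) · ((t ∧ not (z ==ᶠ x)) · 1))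
                                                                (≢⇒==ᶠ-false (λ q → y≢a (sym q)))) (·-zeroʳ _))) ⟩
      sum (λ z → not (z ==ᶠ a) · f a z)
        ≡⟨ sum-cong-≗ (λ z → trans (cong (λ t → not (z ==ᶠ a) · ((t ∧ not (z ==ᶠ x)) · 1)) (==ᶠ-refl a))
                                   (·-∧ (not (z ==ᶠ a)) (not (z ==ᶠ x)))) ⟩
      card (λ z → not (z ==ᶠ a) ∧ not (z ==ᶠ x))
        ≡⟨ card-≢≢ a x a≢x ⟩
      n ∸ 2 ∎
      where
      open ≡-Reasoning
      a≢x : a ≢ x
      a≢x = adj⇒≢ (trans (at a) (==ᶠ-refl a))
      f : Fin n → Fin n → ℕ
      f y z = ((a ==ᶠ y) ∧ not (z ==ᶠ x)) · 1
      split : ∀ y z → y ≢ z → (not (y ==ᶠ x) ∧ not (z ==ᶠ x)) · (inPair y z a · 1) ≡ f y z + f z y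
      split y z y≢z with a ≟ᶠ y | a ≟ᶠ z
      ... | yes refl | yes refl = ⊥-elim (y≢z refl)
      ... | yes refl | no _ rewrite ≢⇒==ᶠ-false a≢x = sym (+-identityʳ _)
      ... | no _ | yes refl rewrite ≢⇒==ᶠ-false a≢x = cong (_· 1) (∧-identityʳ _)
      ... | no _ | no _ = ·-zeroʳ _

    trapPairs-deg2 : ∀ x → card (adj G x) ≡ 2 → trapPairs x ≡ 1
    trapPairs-deg2 x e with a , b , a≢b , at ← card≡2⇒ (adj G x) e = begin
      trapPairs x
        ≡⟨ sumPairs-cong≢ (λ y z y≢z → trans (cong (λ t → (not (y ==ᶠ x) ∧ not (z ==ᶠ x)) · (t · 1)) (trapped-deg2 at y z))
                                             (split y z y≢z)) ⟩
      sumPairs (λ y z → f y z + f z y)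
        ≡⟨ sumPairs-ordered f ⟩
      sum (λ y → sum (λ z → not (z ==ᶠ y) · f y z))
        ≡⟨ sum-single a _ (λ y y≢a → sum-zero _ (λ z → trans (cong (λ t → not (z ==ᶠ y) · ((t ∧ (b ==ᶠ z)) · 1))
                                                                (≢⇒==ᶠ-false (λ q → y≢a (sym q)))) (·-zeroʳ _))) ⟩
      sum (λ z → not (z ==ᶠ a) · f a z)
        ≡⟨ cong (λ t → sum (λ z → not (z ==ᶠ a) · ((t ∧ (b ==ᶠ z)) · 1))) (==ᶠ-refl a) ⟩
      sum (λ z → not (z ==ᶠ a) · ((b ==ᶠ z) · 1))
        ≡⟨ sum-single b _ (λ z z≢b → trans (cong (λ t → not (z ==ᶠ a) · (t · 1)) (≢⇒==ᶠ-false (λ q → z≢b (sym q))))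
                                           (·-zeroʳ _)) ⟩
      not (b ==ᶠ a) · ((b ==ᶠ b) · 1)
        ≡⟨ cong₂ (λ s t → not s · (t · 1)) (≢⇒==ᶠ-false (λ q → a≢b (sym q))) (==ᶠ-refl b) ⟩
      1 ∎
      where
      open ≡-Reasoning
      a≢x : a ≢ x
      a≢x = adj⇒≢ (trans (at a) (inPair-₁ a b))
      b≢x : b ≢ x
      b≢x = adj⇒≢ (trans (at b) (inPair-₂ a b))
      f : Fin n → Fin n → ℕ
      f y z = ((a ==ᶠ y) ∧ (b ==ᶠ z)) · 1
      split : ∀ y z → y ≢ z → (not (y ==ᶠ x) ∧ not (z ==ᶠ x)) · ((inPair y z a ∧ inPair y z b) · 1) ≡ f y z + f z y
      split y z y≢z with a ≟ᶠ y | a ≟ᶠ z | b ≟ᶠ y | b ≟ᶠ z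
      ... | yes refl | yes refl | _        | _        = ⊥-elim (y≢z refl)
      ... | _        | _        | yes refl | yes refl = ⊥-elim (y≢z refl)
      ... | yes refl | _        | yes refl | _        = ⊥-elim (a≢b refl)
      ... | _        | yes refl | _        | yes refl = ⊥-elim (a≢b refl)
      ... | yes refl | no _     | no _     | yes refl rewrite ≢⇒==ᶠ-false a≢x | ≢⇒==ᶠ-false b≢x = refl
      ... | no _     | yes refl | yes refl | no _     rewrite ≢⇒==ᶠ-false a≢x | ≢⇒==ᶠ-false b≢x = refl
      ... | yes refl | no _     | no _     | no _     = ·-zeroʳ _
      ... | no _     | yes refl | no _     | no _     = ·-zeroʳ _
      ... | no _     | no _     | yes refl | no _     = ·-zeroʳ _
      ... | no _     | no _     | no _     | yes refl = ·-zeroʳ _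
      ... | no _     | no _     | no _     | no _     = ·-zeroʳ _

    trapPairs-deg≥3 : ∀ x k → card (adj G x) ≡ 3 + k → trapPairs x ≡ 0
    trapPairs-deg≥3 x k e =
      trans (sumPairs-cong (λ y z → trans (cong (λ t → (not (y ==ᶠ x) ∧ not (z ==ᶠ x)) · (t · 1)) (trapped-deg≥3 k e y z))
                                          (·-zeroʳ _)))
            (sumPairs-zero {n})

    trapPairs-by-degree : ∀ x → trapPairs x ≡ hasDeg G 0 x · ((n ∸ 1) C 2) + hasDeg G 1 x · (n ∸ 2) + hasDeg G 2 x · 1
    trapPairs-by-degree x =
      trans (by-card (card (adj G x)) refl)
            (cong (λ d → (d ≡ᵇ 0) · ((n ∸ 1) C 2) + (d ≡ᵇ 1) · (n ∸ 2) + (d ≡ᵇ 2) · 1) (sym (degree≡card x)))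
      where
      by-card : ∀ d → card (adj G x) ≡ d → trapPairs x ≡ (d ≡ᵇ 0) · ((n ∸ 1) C 2) + (d ≡ᵇ 1) · (n ∸ 2) + (d ≡ᵇ 2) · 1
      by-card 0 e = trans (trapPairs-isolated x e) (sym (trans (+-identityʳ _) (+-identityʳ _)))
      by-card 1 e = trans (trapPairs-leaf x e) (sym (+-identityʳ _))
      by-card 2 e = trapPairs-deg2 x e
      by-card (suc (suc (suc k))) e = trapPairs-deg≥3 x k e

  -- Pairs of trapped vertices

  -- The contribution of a pair {x, y} to the pair term of the inclusion–exclusion, as a function of
  -- m = n − 2 and of the Booleans "x, y isolated", "x, y leaves", "x, y of degree 2", "x ~ y",
  -- "x, y have a common neighbour" and "N[x] = N[y]".
  pairWeight : ℕ → (iₓ iᵧ ℓₓ ℓᵧ tₓ tᵧ a c s : Bool) → ℕ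
  pairWeight m iₓ iᵧ ℓₓ ℓᵧ tₓ tᵧ a c s =
    (iₓ ∧ iᵧ) · m + ((iₓ ∧ ℓᵧ) ∨ (ℓₓ ∧ iᵧ)) · 1 + (a ∧ ℓₓ ∧ ℓᵧ) · m + (ℓₓ ∧ ℓᵧ ∧ c) · 1
    + (a ∧ ((ℓₓ ∧ tᵧ) ∨ (tₓ ∧ ℓᵧ))) · 1 + (tₓ ∧ tᵧ ∧ s) · 1

  pairWeight-swap : ∀ m iₓ iᵧ ℓₓ ℓᵧ tₓ tᵧ a c s →
                    pairWeight m iₓ iᵧ ℓₓ ℓᵧ tₓ tᵧ a c s ≡ pairWeight m iᵧ iₓ ℓᵧ ℓₓ tᵧ tₓ a c s
  pairWeight-swap m iₓ iᵧ ℓₓ ℓᵧ tₓ tᵧ a c s =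
    cong₂ _+_ (cong₂ _+_ (cong₂ _+_ (cong₂ _+_ (cong₂ _+_
      (cong (_· m) (∧-comm iₓ iᵧ))
      (cong (_· 1) (trans (∨-comm (iₓ ∧ ℓᵧ) (ℓₓ ∧ iᵧ)) (cong₂ _∨_ (∧-comm ℓₓ iᵧ) (∧-comm iₓ ℓᵧ)))))
      (cong (λ t → (a ∧ t) · m) (∧-comm ℓₓ ℓᵧ)))
      (cong (_· 1) (∧-swapˡ ℓₓ ℓᵧ c)))
      (cong (λ t → (a ∧ t) · 1) (trans (∨-comm (ℓₓ ∧ tᵧ) (tₓ ∧ ℓᵧ)) (cong₂ _∨_ (∧-comm tₓ ℓᵧ) (∧-comm ℓₓ tᵧ)))))
      (cong (_· 1) (∧-swapˡ tₓ tᵧ s))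
    where
    ∧-swapˡ : ∀ p q r → (p ∧ (q ∧ r)) ≡ (q ∧ (p ∧ r))
    ∧-swapˡ false false r = refl
    ∧-swapˡ false true  r = refl
    ∧-swapˡ true  q     r = refl

  private
    +-identityʳ³ : ∀ m → m + 0 + 0 + 0 ≡ m
    +-identityʳ³ = solve-∀

    +-identityʳ⁵ : ∀ m → m + 0 + 0 + 0 + 0 + 0 ≡ m
    +-identityʳ⁵ = solve-∀

  module _ {n : ℕ} (G : SimpleGraph n) where

    commonNbr : Fin n → Fin n → Bool
    commonNbr x y = any (λ w → adj G x w ∧ adj G y w) (allFin n)

    sameClosedNbr : Fin n → Fin n → Bool
    sameClosedNbr x y = all (λ w → closedNbr G x w ⇔ᵇ closedNbr G y w) (allFin n)

    jointTraps : Fin n → Fin n → ℕ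
    jointTraps x y = sum (λ z → (not (z ==ᶠ x) ∧ not (z ==ᶠ y)) · ((trapped G x y z ∧ trapped G y x z) · 1))

    private
      weight : ℕ → ℕ → Fin n → Fin n → ℕ
      weight d₁ d₂ x y = pairWeight (n ∸ 2) (d₁ ≡ᵇ 0) (d₂ ≡ᵇ 0) (d₁ ≡ᵇ 1) (d₂ ≡ᵇ 1) (d₁ ≡ᵇ 2) (d₂ ≡ᵇ 2)
                                    (adj G x y) (commonNbr x y) (sameClosedNbr x y)

      jointTraps-eval : ∀ x y (q : Fin n → Bool) → (∀ z → (trapped G x y z ∧ trapped G y x z) ≡ q z) →
                        jointTraps x y ≡ sum (λ z → (not (z ==ᶠ x) ∧ not (z ==ᶠ y)) · (q z · 1))
      jointTraps-eval x y q h = sum-cong-≗ (λ z → cong (λ t → (not (z ==ᶠ x) ∧ not (z ==ᶠ y)) · (t · 1)) (h z))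

      jointTraps-everywhere : ∀ x y → x ≢ y → (∀ z → (trapped G x y z ∧ trapped G y x z) ≡ true) → jointTraps x y ≡ n ∸ 2
      jointTraps-everywhere x y x≢y h = trans (jointTraps-eval x y (λ _ → true) h) (card-≢≢ x y x≢y)

      jointTraps-nowhere : ∀ x y → (∀ z → (trapped G x y z ∧ trapped G y x z) ≡ false) → jointTraps x y ≡ 0
      jointTraps-nowhere x y h = trans (jointTraps-eval x y (λ _ → false) h)
                                       (sum-zero _ (λ z → ·-zeroʳ (not (z ==ᶠ x) ∧ not (z ==ᶠ y))))

      jointTraps-at₂ : ∀ x y a c → a ≢ x → a ≢ y → (∀ z → (trapped G x y z ∧ trapped G y x z) ≡ ((a ==ᶠ z) ∧ (c ==ᶠ z))) →
                       jointTraps x y ≡ (c ==ᶠ a) · 1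
      jointTraps-at₂ x y a c a≢x a≢y h = begin
        jointTraps x y
          ≡⟨ jointTraps-eval x y (λ z → (a ==ᶠ z) ∧ (c ==ᶠ z)) h ⟩
        sum (λ z → (not (z ==ᶠ x) ∧ not (z ==ᶠ y)) · (((a ==ᶠ z) ∧ (c ==ᶠ z)) · 1))
          ≡⟨ sum-single a _ (λ z z≢a → trans (cong (λ t → (not (z ==ᶠ x) ∧ not (z ==ᶠ y)) · ((t ∧ (c ==ᶠ z)) · 1))
                                                   (≢⇒==ᶠ-false (λ q → z≢a (sym q))))
                                             (·-zeroʳ _)) ⟩
        (not (a ==ᶠ x) ∧ not (a ==ᶠ y)) · (((a ==ᶠ a) ∧ (c ==ᶠ a)) · 1)
          ≡⟨ cong₂ (λ s t → (not s ∧ not t) · (((a ==ᶠ a) ∧ (c ==ᶠ a)) · 1)) (≢⇒==ᶠ-false a≢x) (≢⇒==ᶠ-false a≢y) ⟩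
        ((a ==ᶠ a) ∧ (c ==ᶠ a)) · 1
          ≡⟨ cong (λ t → (t ∧ (c ==ᶠ a)) · 1) (==ᶠ-refl a) ⟩
        (c ==ᶠ a) · 1 ∎
        where open ≡-Reasoning

      jointTraps-at : ∀ x y c → c ≢ x → c ≢ y → (∀ z → (trapped G x y z ∧ trapped G y x z) ≡ (c ==ᶠ z)) →
                      jointTraps x y ≡ 1
      jointTraps-at x y c c≢x c≢y h =
        trans (jointTraps-at₂ x y c c c≢x c≢y (λ z → trans (h z) (sym (∧-idem (c ==ᶠ z))))) (cong (_· 1) (==ᶠ-refl c))

    private
      ≢-separates : ∀ {c d : Fin n} → c ≢ d → ∀ z → ((c ==ᶠ z) ∧ (d ==ᶠ z)) ≡ false
      ≢-separates {c} {d} c≢d z with c ≟ᶠ z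
      ... | yes refl = ≢⇒==ᶠ-false (λ q → c≢d (sym q))
      ... | no _     = refl

      jointTraps₀₀ : ∀ x y → x ≢ y → card (adj G x) ≡ 0 → card (adj G y) ≡ 0 → jointTraps x y ≡ weight 0 0 x y
      jointTraps₀₀ x y x≢y e₁ e₂ rewrite card≡0⇒ (adj G x) e₁ y =
        trans (jointTraps-everywhere x y x≢y (λ z → cong₂ _∧_ (trapped-isolated G (card≡0⇒ (adj G x) e₁) y z)
                                                              (trapped-isolated G (card≡0⇒ (adj G y) e₂) x z)))
              (sym (+-identityʳ⁵ (n ∸ 2)))

      jointTraps₀₁ : ∀ x y → x ≢ y → card (adj G x) ≡ 0 → card (adj G y) ≡ 1 → jointTraps x y ≡ weight 0 1 x y
      jointTraps₀₁ x y x≢y e₁ e₂ with card≡1⇒ (adj G y) e₂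
      ... | c , at rewrite card≡0⇒ (adj G x) e₁ y =
        jointTraps-at x y c c≢x (adj⇒≢ G (trans (at c) (==ᶠ-refl c)))
          (λ z → cong₂ _∧_ (trapped-isolated G isolated y z) (trans (trapped-leaf G at x z) (cong (_∨ (c ==ᶠ z)) (≢⇒==ᶠ-false c≢x))))
        where
        isolated = card≡0⇒ (adj G x) e₁
        c≢x : c ≢ x
        c≢x refl with () ← trans (sym (isolated y)) (trans (SimpleGraph.sym G c y) (trans (at c) (==ᶠ-refl c)))

      jointTraps₀₂ : ∀ x y → x ≢ y → card (adj G x) ≡ 0 → card (adj G y) ≡ 2 → jointTraps x y ≡ weight 0 2 x y
      jointTraps₀₂ x y x≢y e₁ e₂ with card≡2⇒ (adj G y) e₂
      ... | c , d , c≢d , at rewrite card≡0⇒ (adj G x) e₁ y =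
        jointTraps-nowhere x y (λ z → trans (cong₂ _∧_ (trapped-isolated G isolated y z) (trapped-deg2 G at x z)) (none z))
        where
        isolated = card≡0⇒ (adj G x) e₁
        x∉N[y] : inPair c d x ≡ false
        x∉N[y] = trans (sym (at x)) (trans (SimpleGraph.sym G y x) (isolated y))
        none : ∀ z → (inPair x z c ∧ inPair x z d) ≡ false
        none z rewrite trans (==ᶠ-sym c x) (∨-conicalˡ _ _ x∉N[y]) | trans (==ᶠ-sym d x) (∨-conicalʳ (x ==ᶠ c) _ x∉N[y]) =
          ≢-separates c≢d z

      jointTraps₁₁ : ∀ x y → x ≢ y → card (adj G x) ≡ 1 → card (adj G y) ≡ 1 → jointTraps x y ≡ weight 1 1 x y
      jointTraps₁₁ x y x≢y e₁ e₂ with card≡1⇒ (adj G x) e₁ | card≡1⇒ (adj G y) e₂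
      ... | a , atx | c , aty with a ≟ᶠ y
      ...   | yes a≡y =
        trans (jointTraps-everywhere x y x≢y
                 (λ z → cong₂ _∧_ (trans (trapped-leaf G atx y z) (cong (_∨ (a ==ᶠ z)) (≡⇒==ᶠ a≡y)))
                                  (trans (trapped-leaf G aty x z) (cong (_∨ (c ==ᶠ z)) (≡⇒==ᶠ c≡x)))))
              (sym (value (adj G x y) (commonNbr x y) x~y noCommon))
        where
        x~y : adj G x y ≡ true
        x~y = trans (atx y) (≡⇒==ᶠ (sym a≡y))
        c≡x : c ≡ x
        c≡x = sym (==ᶠ⇒≡ (trans (sym (aty x)) (trans (SimpleGraph.sym G y x) x~y)))
        noCommon : commonNbr x y ≡ false
        noCommon = trans (any-cong (λ w → cong₂ _∧_ (atx w) (aty w)))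
                         (trans (any-single a (_==ᶠ c)) (trans (cong₂ _==ᶠ_ a≡y c≡x) (≢⇒==ᶠ-false (λ q → x≢y (sym q)))))
        value : ∀ p q → p ≡ true → q ≡ false →
                pairWeight (n ∸ 2) false false true true false false p q (sameClosedNbr x y) ≡ n ∸ 2
        value p q refl refl = +-identityʳ³ (n ∸ 2)
      ...   | no a≢y =
        trans (jointTraps-at₂ x y a c a≢x a≢y
                 (λ z → cong₂ _∧_ (trans (trapped-leaf G atx y z) (cong (_∨ (a ==ᶠ z)) (≢⇒==ᶠ-false a≢y)))
                                  (trans (trapped-leaf G aty x z) (cong (_∨ (c ==ᶠ z)) (≢⇒==ᶠ-false c≢x)))))
              (sym (value (adj G x y) (commonNbr x y) x≁y common))
        where
        a≢x : a ≢ x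
        a≢x = adj⇒≢ G (trans (atx a) (==ᶠ-refl a))
        x≁y : adj G x y ≡ false
        x≁y = trans (atx y) (≢⇒==ᶠ-false (λ q → a≢y (sym q)))
        c≢x : c ≢ x
        c≢x refl with () ← trans (sym x≁y) (trans (SimpleGraph.sym G c y) (trans (aty c) (==ᶠ-refl c)))
        common : commonNbr x y ≡ (c ==ᶠ a)
        common = trans (any-cong (λ w → cong₂ _∧_ (atx w) (aty w))) (trans (any-single a (_==ᶠ c)) (==ᶠ-sym a c))
        value : ∀ p q → p ≡ false → q ≡ (c ==ᶠ a) →
                pairWeight (n ∸ 2) false false true true false false p q (sameClosedNbr x y) ≡ (c ==ᶠ a) · 1
        value p q refl refl = trans (+-identityʳ _) (+-identityʳ _)

      jointTraps₁₂ : ∀ x y → x ≢ y → card (adj G x) ≡ 1 → card (adj G y) ≡ 2 → jointTraps x y ≡ weight 1 2 x y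
      jointTraps₁₂ x y x≢y e₁ e₂ with card≡1⇒ (adj G x) e₁ | card≡2⇒ (adj G y) e₂
      ... | a , atx | c , d , c≢d , aty with a ≟ᶠ y | c ≟ᶠ x
      ...   | yes a≡y | yes c≡x = trans (jointTraps-at x y d d≢x d≢y joint) (sym (value (adj G x y) x~y))
        where
        x~y : adj G x y ≡ true
        x~y = trans (atx y) (≡⇒==ᶠ (sym a≡y))
        d≢x : d ≢ x
        d≢x d≡x = c≢d (trans c≡x (sym d≡x))
        d≢y : d ≢ y
        d≢y = adj⇒≢ G (trans (aty d) (inPair-₂ c d))
        joint : ∀ z → (trapped G x y z ∧ trapped G y x z) ≡ (d ==ᶠ z)
        joint z rewrite trapped-leaf G atx y z | ≡⇒==ᶠ a≡y | trapped-deg2 G aty x z | ≡⇒==ᶠ c≡x | ≢⇒==ᶠ-false d≢x = refl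
        value : ∀ p → p ≡ true → pairWeight (n ∸ 2) false false true false false true p (commonNbr x y) (sameClosedNbr x y) ≡ 1
        value p refl = refl
      ...   | yes a≡y | no c≢x = trans (jointTraps-at x y c c≢x c≢y joint) (sym (value (adj G x y) x~y))
        where
        x~y : adj G x y ≡ true
        x~y = trans (atx y) (≡⇒==ᶠ (sym a≡y))
        d≡x : (d ==ᶠ x) ≡ true
        d≡x = trans (==ᶠ-sym d x) (trans (cong (_∨ (x ==ᶠ d)) (sym (≢⇒==ᶠ-false (λ p → c≢x (sym p)))))
                                         (trans (sym (aty x)) (trans (SimpleGraph.sym G y x) x~y)))
        c≢y : c ≢ y
        c≢y = adj⇒≢ G (trans (aty c) (inPair-₁ c d))
        joint : ∀ z → (trapped G x y z ∧ trapped G y x z) ≡ (c ==ᶠ z)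
        joint z rewrite trapped-leaf G atx y z | ≡⇒==ᶠ a≡y | trapped-deg2 G aty x z | ≢⇒==ᶠ-false c≢x | d≡x = ∧-identityʳ _
        value : ∀ p → p ≡ true → pairWeight (n ∸ 2) false false true false false true p (commonNbr x y) (sameClosedNbr x y) ≡ 1
        value p refl = refl
      ...   | no a≢y | _ = trans (jointTraps-nowhere x y joint) (sym (value (adj G x y) x≁y))
        where
        x≁y : adj G x y ≡ false
        x≁y = trans (atx y) (≢⇒==ᶠ-false (λ q → a≢y (sym q)))
        x∉N[y] : inPair c d x ≡ false
        x∉N[y] = trans (sym (aty x)) (trans (SimpleGraph.sym G y x) x≁y)
        joint : ∀ z → (trapped G x y z ∧ trapped G y x z) ≡ false
        joint z rewrite trapped-deg2 G aty x z | trans (==ᶠ-sym c x) (∨-conicalˡ _ _ x∉N[y])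
                      | trans (==ᶠ-sym d x) (∨-conicalʳ (x ==ᶠ c) _ x∉N[y]) | ≢-separates c≢d z = ∧-zeroʳ _
        value : ∀ p → p ≡ false → pairWeight (n ∸ 2) false false true false false true p (commonNbr x y) (sameClosedNbr x y) ≡ 0
        value p refl = refl

      other-nbr : ∀ {x a b y} → a ≢ b → (∀ w → adj G x w ≡ inPair a b w) → adj G x y ≡ true →
                  Σ[ b′ ∈ Fin n ] (b′ ≢ y × (∀ w → adj G x w ≡ inPair y b′ w))
      other-nbr {x} {a} {b} {y} a≢b at x~y with y ≟ᶠ a
      ... | yes refl = b , (λ p → a≢b (sym p)) , at
      ... | no y≢a = a , (λ p → y≢a (sym p))
                   , (λ w → trans (at w) (trans (∨-comm (w ==ᶠ a) (w ==ᶠ b)) (cong (λ t → (w ==ᶠ t) ∨ (w ==ᶠ a)) (sym y≡b))))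
        where
        y≡b : y ≡ b
        y≡b = ==ᶠ⇒≡ (trans (cong (_∨ (y ==ᶠ b)) (sym (≢⇒==ᶠ-false y≢a))) (trans (sym (at y)) x~y))

      sameClosedNbr-adjacent : ∀ {x y b′ d′} → b′ ≢ x → b′ ≢ y →
        (∀ w → adj G x w ≡ inPair y b′ w) → (∀ w → adj G y w ≡ inPair x d′ w) → sameClosedNbr x y ≡ (d′ ==ᶠ b′)
      sameClosedNbr-adjacent {x} {y} {b′} {d′} b′≢x b′≢y atx′ aty′ with d′ ≟ᶠ b′
      ... | yes refl = trans (all-cong closed) (∀⇒all _ (λ w → trans (cong (((x ==ᶠ w) ∨ inPair y d′ w) ⇔ᵇ_) (swap w))
                                                                  (⇔ᵇ-refl ((x ==ᶠ w) ∨ inPair y d′ w))))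
        where
        closed : ∀ w → (closedNbr G x w ⇔ᵇ closedNbr G y w) ≡ (((x ==ᶠ w) ∨ inPair y d′ w) ⇔ᵇ ((y ==ᶠ w) ∨ inPair x d′ w))
        closed w = cong₂ _⇔ᵇ_ (cong ((x ==ᶠ w) ∨_) (atx′ w)) (cong ((y ==ᶠ w) ∨_) (aty′ w))
        swap : ∀ w → ((y ==ᶠ w) ∨ inPair x d′ w) ≡ ((x ==ᶠ w) ∨ inPair y d′ w)
        swap w rewrite ==ᶠ-sym y w | ==ᶠ-sym w x = ∨-swapˡ (w ==ᶠ y) (x ==ᶠ w) (w ==ᶠ d′)
      ... | no d′≢b′ = trans (all-cong closed) (all-false-at _ b′ separated)
        where
        closed : ∀ w → (closedNbr G x w ⇔ᵇ closedNbr G y w) ≡ (((x ==ᶠ w) ∨ inPair y b′ w) ⇔ᵇ ((y ==ᶠ w) ∨ inPair x d′ w))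
        closed w = cong₂ _⇔ᵇ_ (cong ((x ==ᶠ w) ∨_) (atx′ w)) (cong ((y ==ᶠ w) ∨_) (aty′ w))
        separated : (((x ==ᶠ b′) ∨ inPair y b′ b′) ⇔ᵇ ((y ==ᶠ b′) ∨ inPair x d′ b′)) ≡ false
        separated rewrite ==ᶠ-refl b′ | ≢⇒==ᶠ-false (λ q → b′≢x (sym q)) | ≢⇒==ᶠ-false (λ q → b′≢y (sym q))
                        | ≢⇒==ᶠ-false b′≢x | ≢⇒==ᶠ-false (λ q → d′≢b′ (sym q)) | ≢⇒==ᶠ-false b′≢y = refl

      jointTraps₂₂ : ∀ x y → x ≢ y → card (adj G x) ≡ 2 → card (adj G y) ≡ 2 → jointTraps x y ≡ weight 2 2 x y
      jointTraps₂₂ x y x≢y e₁ e₂ with card≡2⇒ (adj G x) e₁ | card≡2⇒ (adj G y) e₂ | adj G x y in x~y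
      ... | a , b , a≢b , atx | c , d , c≢d , aty | true
        with b′ , b′≢y , atx′ ← other-nbr a≢b atx x~y | d′ , d′≢x , aty′ ← other-nbr c≢d aty (trans (SimpleGraph.sym G y x) x~y) =
        trans (jointTraps-at₂ x y b′ d′ b′≢x b′≢y joint) (cong (_· 1) (sym (sameClosedNbr-adjacent b′≢x b′≢y atx′ aty′)))
        where
        b′≢x : b′ ≢ x
        b′≢x = adj⇒≢ G (trans (atx′ b′) (inPair-₂ y b′))
        joint : ∀ z → (trapped G x y z ∧ trapped G y x z) ≡ ((b′ ==ᶠ z) ∧ (d′ ==ᶠ z))
        joint z rewrite trapped-deg2 G atx′ y z | trapped-deg2 G aty′ x z | ==ᶠ-refl y | ==ᶠ-refl x
                      | ≢⇒==ᶠ-false b′≢y | ≢⇒==ᶠ-false d′≢x = refl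
      ... | a , b , a≢b , atx | c , d , c≢d , aty | false =
        trans (jointTraps-nowhere x y joint) (cong (_· 1) (sym distinct))
        where
        y∉N[x] : inPair a b y ≡ false
        y∉N[x] = trans (sym (atx y)) x~y
        joint : ∀ z → (trapped G x y z ∧ trapped G y x z) ≡ false
        joint z rewrite trapped-deg2 G atx y z | trans (==ᶠ-sym a y) (∨-conicalˡ _ _ y∉N[x])
                      | trans (==ᶠ-sym b y) (∨-conicalʳ (y ==ᶠ a) _ y∉N[x]) | ≢-separates a≢b z = refl
        distinct : sameClosedNbr x y ≡ false
        distinct = all-false-at _ y separated
          where
          separated : (closedNbr G x y ⇔ᵇ closedNbr G y y) ≡ false
          separated rewrite ≢⇒==ᶠ-false x≢y | x~y | ==ᶠ-refl y = refl

      jointTraps≥3 : ∀ x y k d₂ → card (adj G x) ≡ 3 + k → jointTraps x y ≡ weight (3 + k) d₂ x y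
      jointTraps≥3 x y k d₂ e = trans (jointTraps-nowhere x y (λ z → cong (_∧ trapped G y x z) (trapped-deg≥3 G k e y z)))
                                      (sym (value (adj G x y)))
        where
        value : ∀ p → pairWeight (n ∸ 2) false (d₂ ≡ᵇ 0) false (d₂ ≡ᵇ 1) false (d₂ ≡ᵇ 2) p (commonNbr x y) (sameClosedNbr x y) ≡ 0
        value true  = refl
        value false = refl

      jointTraps-sym : ∀ x y → jointTraps x y ≡ jointTraps y x
      jointTraps-sym x y = sum-cong-≗ (λ z → cong₂ (λ s t → s · (t · 1)) (∧-comm (not (z ==ᶠ x)) (not (z ==ᶠ y)))
                                                                     (∧-comm (trapped G x y z) (trapped G y x z)))

      weight-swap : ∀ d₁ d₂ x y → weight d₂ d₁ y x ≡ weight d₁ d₂ x y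
      weight-swap d₁ d₂ x y = begin
        weight d₂ d₁ y x
          ≡⟨ pairWeight-swap (n ∸ 2) (d₂ ≡ᵇ 0) (d₁ ≡ᵇ 0) (d₂ ≡ᵇ 1) (d₁ ≡ᵇ 1) (d₂ ≡ᵇ 2) (d₁ ≡ᵇ 2) _ _ _ ⟩
        pairWeight (n ∸ 2) (d₁ ≡ᵇ 0) (d₂ ≡ᵇ 0) (d₁ ≡ᵇ 1) (d₂ ≡ᵇ 1) (d₁ ≡ᵇ 2) (d₂ ≡ᵇ 2)
                   (adj G y x) (commonNbr y x) (sameClosedNbr y x)
          ≡⟨ cong₂ (λ p q → pairWeight (n ∸ 2) (d₁ ≡ᵇ 0) (d₂ ≡ᵇ 0) (d₁ ≡ᵇ 1) (d₂ ≡ᵇ 1) (d₁ ≡ᵇ 2) (d₂ ≡ᵇ 2) p (commonNbr y x) q)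
                   (SimpleGraph.sym G y x) (all-cong (λ w → ⇔ᵇ-comm (closedNbr G y w) (closedNbr G x w))) ⟩
        pairWeight (n ∸ 2) (d₁ ≡ᵇ 0) (d₂ ≡ᵇ 0) (d₁ ≡ᵇ 1) (d₂ ≡ᵇ 1) (d₁ ≡ᵇ 2) (d₂ ≡ᵇ 2)
                   (adj G x y) (commonNbr y x) (sameClosedNbr x y)
          ≡⟨ cong (λ c → pairWeight (n ∸ 2) (d₁ ≡ᵇ 0) (d₂ ≡ᵇ 0) (d₁ ≡ᵇ 1) (d₂ ≡ᵇ 1) (d₁ ≡ᵇ 2) (d₂ ≡ᵇ 2)
                                    (adj G x y) c (sameClosedNbr x y))
                  (any-cong (λ w → ∧-comm (adj G y w) (adj G x w))) ⟩
        weight d₁ d₂ x y ∎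
        where open ≡-Reasoning

      swapped : ∀ x y d₁ d₂ → jointTraps y x ≡ weight d₂ d₁ y x → jointTraps x y ≡ weight d₁ d₂ x y
      swapped x y d₁ d₂ h = trans (jointTraps-sym x y) (trans h (weight-swap d₁ d₂ x y))

      jointTraps-by-degree : ∀ x y → x ≢ y → ∀ d₁ d₂ → card (adj G x) ≡ d₁ → card (adj G y) ≡ d₂ →
                             jointTraps x y ≡ weight d₁ d₂ x y
      jointTraps-by-degree x y x≢y 0 0 e₁ e₂ = jointTraps₀₀ x y x≢y e₁ e₂
      jointTraps-by-degree x y x≢y 0 1 e₁ e₂ = jointTraps₀₁ x y x≢y e₁ e₂
      jointTraps-by-degree x y x≢y 0 2 e₁ e₂ = jointTraps₀₂ x y x≢y e₁ e₂
      jointTraps-by-degree x y x≢y 1 1 e₁ e₂ = jointTraps₁₁ x y x≢y e₁ e₂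
      jointTraps-by-degree x y x≢y 1 2 e₁ e₂ = jointTraps₁₂ x y x≢y e₁ e₂
      jointTraps-by-degree x y x≢y 2 2 e₁ e₂ = jointTraps₂₂ x y x≢y e₁ e₂
      jointTraps-by-degree x y x≢y (suc (suc (suc k))) d₂ e₁ e₂ = jointTraps≥3 x y k d₂ e₁
      jointTraps-by-degree x y x≢y 1 0 e₁ e₂ = swapped x y 1 0 (jointTraps₀₁ y x (λ p → x≢y (sym p)) e₂ e₁)
      jointTraps-by-degree x y x≢y 2 0 e₁ e₂ = swapped x y 2 0 (jointTraps₀₂ y x (λ p → x≢y (sym p)) e₂ e₁)
      jointTraps-by-degree x y x≢y 2 1 e₁ e₂ = swapped x y 2 1 (jointTraps₁₂ y x (λ p → x≢y (sym p)) e₂ e₁)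
      jointTraps-by-degree x y x≢y 0 (suc (suc (suc k))) e₁ e₂ = swapped x y 0 (3 + k) (jointTraps≥3 y x k 0 e₂)
      jointTraps-by-degree x y x≢y 1 (suc (suc (suc k))) e₁ e₂ = swapped x y 1 (3 + k) (jointTraps≥3 y x k 1 e₂)
      jointTraps-by-degree x y x≢y 2 (suc (suc (suc k))) e₁ e₂ = swapped x y 2 (3 + k) (jointTraps≥3 y x k 2 e₂)

    jointTraps≡pairWeight : ∀ x y → x ≢ y →
      jointTraps x y ≡ pairWeight (n ∸ 2) (hasDeg G 0 x) (hasDeg G 0 y) (hasDeg G 1 x) (hasDeg G 1 y) (hasDeg G 2 x) (hasDeg G 2 y)
                                  (adj G x y) (commonNbr x y) (sameClosedNbr x y)
    jointTraps≡pairWeight x y x≢y =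
      trans (jointTraps-by-degree x y x≢y _ _ refl refl)
            (cong₂ (λ d₁ d₂ → weight d₁ d₂ x y) (sym (degree≡card G x)) (sym (degree≡card G y)))

  -- Triples of trapped vertices

  -- The triple term of the inclusion–exclusion for a triple {u, v, w}, as a function of the Booleans
  -- "u, v, w isolated", "u, v, w leaves", p = u ~ v, q = u ~ w, r = v ~ w, and c = "{u, v, w} is closed".
  tripleWeight : (iᵤ iᵥ i𝓌 ℓᵤ ℓᵥ ℓ𝓌 p q r c : Bool) → ℕ
  tripleWeight iᵤ iᵥ i𝓌 ℓᵤ ℓᵥ ℓ𝓌 p q r c =
    (iᵤ ∧ iᵥ ∧ i𝓌) · 1 + ((iᵤ ∧ r ∧ ℓᵥ ∧ ℓ𝓌) ∨ (iᵥ ∧ q ∧ ℓᵤ ∧ ℓ𝓌) ∨ (i𝓌 ∧ p ∧ ℓᵤ ∧ ℓᵥ)) · 1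
    + (c ∧ ((p ∧ r ∧ not q) ∨ (p ∧ q ∧ not r) ∨ (q ∧ r ∧ not p))) · 1 + (c ∧ p ∧ q ∧ r) · 1

  -- A closed triple is three isolated vertices, an isolated vertex and a K₂, a P₃ or a K₃, according to its edges.
  tripleWeight-closed : ∀ p q r → let dᵤ = p · 1 + q · 1; dᵥ = p · 1 + r · 1; d𝓌 = q · 1 + r · 1 in
    tripleWeight (dᵤ ≡ᵇ 0) (dᵥ ≡ᵇ 0) (d𝓌 ≡ᵇ 0) (dᵤ ≡ᵇ 1) (dᵥ ≡ᵇ 1) (d𝓌 ≡ᵇ 1) p q r true ≡ 1
  tripleWeight-closed false false false = refl
  tripleWeight-closed false false true  = refl
  tripleWeight-closed false true  false = refl
  tripleWeight-closed false true  true  = refl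
  tripleWeight-closed true  false false = refl
  tripleWeight-closed true  false true  = refl
  tripleWeight-closed true  true  false = refl
  tripleWeight-closed true  true  true  = refl

  module _ {n : ℕ} (G : SimpleGraph n) where

    isIsolated : Fin n → Bool
    isIsolated = hasDeg G 0

    isK2 : Fin n → Fin n → Bool
    isK2 x y = adj G x y ∧ isLeaf G x ∧ isLeaf G y

    -- {u, v, w} is a union of components.
    closedTriple : Fin n → Fin n → Fin n → Bool
    closedTriple u v w = trapped G u v w ∧ trapped G v u w ∧ trapped G w u v

    isolatedAndK2 : Fin n → Fin n → Fin n → Bool
    isolatedAndK2 u v w = (isIsolated u ∧ isK2 v w) ∨ (isIsolated v ∧ isK2 u w) ∨ (isIsolated w ∧ isK2 u v)

    twoEdges : Fin n → Fin n → Fin n → Bool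
    twoEdges u v w = (adj G u v ∧ adj G v w ∧ not (adj G u w)) ∨ (adj G u v ∧ adj G u w ∧ not (adj G v w))
                     ∨ (adj G u w ∧ adj G v w ∧ not (adj G u v))

    isP3 : Fin n → Fin n → Fin n → Bool
    isP3 u v w = closedTriple u v w ∧ twoEdges u v w

    isK3 : Fin n → Fin n → Fin n → Bool
    isK3 u v w = closedTriple u v w ∧ adj G u v ∧ adj G u w ∧ adj G v w

    hasDeg⇒card : ∀ {x} d → hasDeg G d x ≡ true → card (adj G x) ≡ d
    hasDeg⇒card {x} d h = trans (sym (degree≡card G x)) (≡ᵇ-true⇒≡ h)

    isolated⇒¬adj : ∀ {x} → isIsolated x ≡ true → ∀ y → adj G x y ≡ false
    isolated⇒¬adj h = card≡0⇒ (adj G _) (hasDeg⇒card 0 h)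

    isolated⇒trapped : ∀ {x} → isIsolated x ≡ true → ∀ y z → trapped G x y z ≡ true
    isolated⇒trapped h = trapped-isolated G (isolated⇒¬adj h)

    leaf⇒adj : ∀ {x y} → isLeaf G x ≡ true → adj G x y ≡ true → ∀ w → adj G x w ≡ (w ==ᶠ y)
    leaf⇒adj {x} {y} h x~y w with a , at ← card≡1⇒ (adj G x) (hasDeg⇒card 1 h) =
      trans (at w) (cong (w ==ᶠ_) (sym (==ᶠ⇒≡ (trans (sym (at y)) x~y))))

    leaf⇒trapped : ∀ {x y} → isLeaf G x ≡ true → adj G x y ≡ true → ∀ z → trapped G x y z ≡ true
    leaf⇒trapped {x} {y} h x~y z = trans (trapped-leaf G (leaf⇒adj h x~y) y z) (cong (_∨ (y ==ᶠ z)) (==ᶠ-refl y))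

    isK2⇒trapped : ∀ {x y} → isK2 x y ≡ true → ∀ z → trapped G x y z ≡ true × trapped G y x z ≡ true
    isK2⇒trapped {x} {y} h z =
      leaf⇒trapped (∧-conicalˡ _ _ (∧-conicalʳ (adj G x y) _ h)) x~y z ,
      leaf⇒trapped (∧-conicalʳ (isLeaf G x) _ (∧-conicalʳ (adj G x y) _ h)) (trans (SimpleGraph.sym G y x) x~y) z
      where
      x~y = ∧-conicalˡ _ _ h

    trapped⇒card-adj : ∀ {u v w} → v ≢ w → trapped G u v w ≡ true → card (adj G u) ≡ adj G u v · 1 + adj G u w · 1
    trapped⇒card-adj {u} {v} {w} v≢w h =
      trans (card-cong pointwise) (trans (card-∨ _ _ disjoint) (cong₂ _+_ (single v) (single w)))
      where
      pointwise : ∀ y → adj G u y ≡ (((y ==ᶠ v) ∧ adj G u v) ∨ ((y ==ᶠ w) ∧ adj G u w))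
      pointwise y with y ≟ᶠ v | y ≟ᶠ w
      ... | yes refl | yes refl = ⊥-elim (v≢w refl)
      ... | yes refl | no _     = sym (∨-identityʳ _)
      ... | no _     | yes refl = refl
      ... | no y≢v   | no y≢w   = contraposeᵇ (all⇒ᵇ-elim (inPair v w) (adj G u) h y)
                                              (cong₂ _∨_ (≢⇒==ᶠ-false y≢v) (≢⇒==ᶠ-false y≢w))
      disjoint : ∀ y → (((y ==ᶠ v) ∧ adj G u v) ∧ ((y ==ᶠ w) ∧ adj G u w)) ≡ false
      disjoint y with y ≟ᶠ v
      ... | no _     = refl
      ... | yes refl rewrite ≢⇒==ᶠ-false v≢w = ∧-zeroʳ _
      single : ∀ t → card (λ y → (y ==ᶠ t) ∧ adj G u t) ≡ adj G u t · 1
      single t with adj G u t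
      ... | true  = trans (card-cong (λ y → ∧-identityʳ (y ==ᶠ t))) (card-≡ t)
      ... | false = trans (card-cong (λ y → ∧-zeroʳ (y ==ᶠ t))) (sum-replicate-zero n)

    isolated⇒closed : ∀ u v w → (isIsolated u ∧ isIsolated v ∧ isIsolated w) ≡ true → closedTriple u v w ≡ true
    isolated⇒closed u v w h =
      ∧-intro (isolated⇒trapped (∧-conicalˡ _ _ h) v w)
              (∧-intro (isolated⇒trapped (∧-conicalˡ _ _ (∧-conicalʳ (isIsolated u) _ h)) u w)
                       (isolated⇒trapped (∧-conicalʳ (isIsolated v) _ (∧-conicalʳ (isIsolated u) _ h)) u v))

    isolatedAndK2⇒closed : ∀ u v w → isolatedAndK2 u v w ≡ true → closedTriple u v w ≡ true
    isolatedAndK2⇒closed u v w h = ∨-elim₃ h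
      (λ d → let k = isK2⇒trapped (∧-conicalʳ (isIsolated u) _ d) u in
         ∧-intro (isolated⇒trapped (∧-conicalˡ _ _ d) v w)
                 (∧-intro (trans (trapped-sym G v u w) (proj₁ k)) (trans (trapped-sym G w u v) (proj₂ k))))
      (λ d → let k = isK2⇒trapped (∧-conicalʳ (isIsolated v) _ d) v in
         ∧-intro (trans (trapped-sym G u v w) (proj₁ k)) (∧-intro (isolated⇒trapped (∧-conicalˡ _ _ d) u w) (proj₂ k)))
      (λ d → let k = isK2⇒trapped (∧-conicalʳ (isIsolated w) _ d) w in
         ∧-intro (proj₁ k) (∧-intro (proj₂ k) (isolated⇒trapped (∧-conicalˡ _ _ d) u v)))

    closedTriple-split : ∀ u v w → u ≢ v → u ≢ w → v ≢ w →
      closedTriple u v w · 1 ≡ (isIsolated u ∧ isIsolated v ∧ isIsolated w) · 1 + isolatedAndK2 u v w · 1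
                               + isP3 u v w · 1 + isK3 u v w · 1
    closedTriple-split u v w u≢v u≢w v≢w = by-value (closedTriple u v w) refl
      where
      p = adj G u v
      q = adj G u w
      r = adj G v w
      weightAt : ℕ → ℕ → ℕ → Bool → ℕ
      weightAt dᵤ dᵥ d𝓌 c = tripleWeight (dᵤ ≡ᵇ 0) (dᵥ ≡ᵇ 0) (d𝓌 ≡ᵇ 0) (dᵤ ≡ᵇ 1) (dᵥ ≡ᵇ 1) (d𝓌 ≡ᵇ 1) p q r c

      by-value : ∀ b → closedTriple u v w ≡ b →
        closedTriple u v w · 1 ≡ (isIsolated u ∧ isIsolated v ∧ isIsolated w) · 1 + isolatedAndK2 u v w · 1
                                 + isP3 u v w · 1 + isK3 u v w · 1
      by-value false closed = trans (cong (_· 1) closed) (sym (cong₂ _+_ (cong₂ _+_ (cong₂ _+_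
        (cong (_· 1) (contraposeᵇ (isolated⇒closed u v w) closed))
        (cong (_· 1) (contraposeᵇ (isolatedAndK2⇒closed u v w) closed)))
        (cong (λ c → (c ∧ _) · 1) closed))
        (cong (λ c → (c ∧ _) · 1) closed)))
      by-value true closed = begin
        closedTriple u v w · 1
          ≡⟨ cong (_· 1) closed ⟩
        1
          ≡⟨ sym (tripleWeight-closed p q r) ⟩
        weightAt (p · 1 + q · 1) (p · 1 + r · 1) (q · 1 + r · 1) true
          ≡⟨ cong₂ (λ dᵤ dᵥ → weightAt dᵤ dᵥ (q · 1 + r · 1) true) (sym degᵤ) (sym degᵥ) ⟩
        weightAt (degree G u) (degree G v) (q · 1 + r · 1) true
          ≡⟨ cong₂ (weightAt (degree G u) (degree G v)) (sym deg𝓌) (sym closed) ⟩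
        weightAt (degree G u) (degree G v) (degree G w) (closedTriple u v w) ∎
        where
        open ≡-Reasoning
        degᵤ : degree G u ≡ p · 1 + q · 1
        degᵤ = trans (degree≡card G u) (trapped⇒card-adj v≢w (∧-conicalˡ _ _ closed))
        degᵥ : degree G v ≡ p · 1 + r · 1
        degᵥ = trans (degree≡card G v) (trans (trapped⇒card-adj u≢w (∧-conicalˡ _ _ (∧-conicalʳ (trapped G u v w) _ closed)))
                                              (cong (λ t → t · 1 + r · 1) (SimpleGraph.sym G v u)))
        deg𝓌 : degree G w ≡ q · 1 + r · 1
        deg𝓌 = trans (degree≡card G w)
                     (trans (trapped⇒card-adj u≢v (∧-conicalʳ (trapped G v u w) _ (∧-conicalʳ (trapped G u v w) _ closed)))
                            (cong₂ (λ s t → s · 1 + t · 1) (SimpleGraph.sym G w u) (SimpleGraph.sym G w v)))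

  -- Walks and components

  module _ {n : ℕ} (G : SimpleGraph n) where

    walkWithin-refl : ∀ k a → walkWithin G k a a ≡ true
    walkWithin-refl zero    a = ==ᶠ-refl a
    walkWithin-refl (suc k) a = ∨-introˡ _ (walkWithin-refl k a)

    walkWithin-mono : ∀ {k l} → k ≤ l → ∀ {a b} → walkWithin G k a b ≡ true → walkWithin G l a b ≡ true
    walkWithin-mono {k} {l} k≤l {a} {b} e = go l k≤l
      where
      go : ∀ l → k ≤ l → walkWithin G l a b ≡ true
      go l k≤l with k ≟ℕ l
      ... | yes refl = e
      go (suc l) k≤l | no k≢l = ∨-introˡ _ (go l (≤-pred (≤∧≢⇒< k≤l k≢l)))
      go zero    z≤n | no k≢l = ⊥-elim (k≢l refl)

    walkWithin-step : ∀ k {a b c} → walkWithin G k a b ≡ true → adj G b c ≡ true → walkWithin G (suc k) a c ≡ true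
    walkWithin-step k {a} {b} {c} e b~c = ∨-introʳ (walkWithin G k a c) (∃⇒any _ b (∧-intro e b~c))

    walkWithin-closed : (S : Fin n → Bool) → (∀ a b → S a ≡ true → adj G a b ≡ true → S b ≡ true) →
                        ∀ k {a b} → S a ≡ true → walkWithin G k a b ≡ true → S b ≡ true
    walkWithin-closed S closed zero    {a} {b} ca e = subst (λ t → S t ≡ true) (==ᶠ⇒≡ e) ca
    walkWithin-closed S closed (suc k) {a} {b} ca e with walkWithin G k a b in w
    ... | true  = walkWithin-closed S closed k ca w
    ... | false with c , hc ← any⇒∃ _ e =
      closed c b (walkWithin-closed S closed k ca (∧-conicalˡ _ _ hc)) (∧-conicalʳ (walkWithin G k a c) _ hc)

    isComponent-intro : (S : Subset n) (r : Fin n) → lookup S r ≡ true → (∀ y → lookup S y ≡ true → reachable G r y ≡ true) →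
      (∀ a b → lookup S a ≡ true → adj G a b ≡ true → lookup S b ≡ true) → isComponent G S ≡ true
    isComponent-intro S r r∈S reach closed =
      ∃⇒any _ r (∧-intro r∈S (∀⇒all _ (λ y → ≡⇒⇔ᵇ (⇔→≡ (mk⇔ (reach y) (walkWithin-closed (lookup S) closed n r∈S))))))

    isComponent-elim : (S : Subset n) → isComponent G S ≡ true →
                       Σ[ r ∈ Fin n ] (lookup S r ≡ true × (∀ y → lookup S y ≡ reachable G r y))
    isComponent-elim S h with r , hr ← any⇒∃ _ h =
      r , ∧-conicalˡ _ _ hr , (λ y → ⇔ᵇ⇒≡ (all⇒∀ _ (∧-conicalʳ (lookup S r) _ hr) y))

    module _ {m : ℕ} (H : SimpleGraph m) (S : Subset n) where

      IsInducedIso : Vec (Fin n) m → Set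
      IsInducedIso f = (∀ i j → ((lookup f i ==ᶠ lookup f j) ⇒ᵇ (i ==ᶠ j)) ≡ true)
                     × (∀ y → lookup S y ≡ any (λ i → lookup f i ==ᶠ y) (allFin m))
                     × (∀ i j → adj G (lookup f i) (lookup f j) ≡ adj H i j)

      inducedIsoTo-intro : (f : Vec (Fin n) m) → IsInducedIso f → inducedIsoTo G H S ≡ true
      inducedIsoTo-intro f (injective , image , edges) = any-allMaps _ f
        (∧-intro (∀⇒all _ (λ i → ∀⇒all _ (λ j → injective i j)))
        (∧-intro (∀⇒all _ (λ y → ≡⇒⇔ᵇ (image y)))
                 (∀⇒all _ (λ i → ∀⇒all _ (λ j → ≡⇒⇔ᵇ (edges i j))))))

      inducedIsoTo-elim : inducedIsoTo G H S ≡ true → Σ[ f ∈ Vec (Fin n) m ] IsInducedIso f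
      inducedIsoTo-elim h with f , hf ← any⇒witness _ (allMaps m n) h =
        f , (λ i j → all⇒∀ _ (all⇒∀ _ (∧-conicalˡ _ _ hf) i) j)
          , (λ y → ⇔ᵇ⇒≡ (all⇒∀ _ (∧-conicalˡ _ _ (∧-conicalʳ (all _ (allFin m)) _ hf)) y))
          , (λ i j → ⇔ᵇ⇒≡ (all⇒∀ _ (all⇒∀ _ (∧-conicalʳ (all _ (allFin n)) _ (∧-conicalʳ (all _ (allFin m)) _ hf)) i) j))

  module _ {n : ℕ} where

    image₂ : ∀ (a b y : Fin n) → any (λ i → lookup (a ∷ b ∷ []) i ==ᶠ y) (allFin 2) ≡ inPair a b y
    image₂ a b y rewrite ==ᶠ-sym a y | ==ᶠ-sym b y = cong ((y ==ᶠ a) ∨_) (∨-identityʳ (y ==ᶠ b))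

    image₃ : ∀ (a b c y : Fin n) → any (λ i → lookup (a ∷ b ∷ c ∷ []) i ==ᶠ y) (allFin 3) ≡ inTriple a b c y
    image₃ a b c y rewrite ==ᶠ-sym a y | ==ᶠ-sym b y | ==ᶠ-sym c y = cong (λ t → (y ==ᶠ a) ∨ (y ==ᶠ b) ∨ t) (∨-identityʳ (y ==ᶠ c))

    ⇒ᵇ-false⇒≢ : ∀ {x y : Fin n} → ((x ==ᶠ y) ⇒ᵇ false) ≡ true → x ≢ y
    ⇒ᵇ-false⇒≢ {x} e refl with () ← trans (sym e) (cong (λ t → t ⇒ᵇ false) (==ᶠ-refl x))

    ≢⇒⇒ᵇ : ∀ {x y : Fin n} {b} → x ≢ y → ((x ==ᶠ y) ⇒ᵇ b) ≡ true
    ≢⇒⇒ᵇ x≢y rewrite ≢⇒==ᶠ-false x≢y = refl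

  module _ {n : ℕ} (G : SimpleGraph n) where

    private
      adj-flip : ∀ {m} (H : SimpleGraph m) {x y i j} → adj G x y ≡ adj H i j → adj G y x ≡ adj H j i
      adj-flip H {x} {y} {i} {j} e = trans (SimpleGraph.sym G y x) (trans e (SimpleGraph.sym H i j))

      adj-diag : ∀ {m} (H : SimpleGraph m) x i → adj G x x ≡ adj H i i
      adj-diag H x i = trans (SimpleGraph.irrefl G x) (sym (SimpleGraph.irrefl H i))

    inducedIsoTo₂-intro : (H : SimpleGraph 2) (S : Subset n) (a b : Fin n) → a ≢ b → (∀ y → lookup S y ≡ inPair a b y) →
                          adj G a b ≡ adj H 0F 1F → inducedIsoTo G H S ≡ true
    inducedIsoTo₂-intro H S a b a≢b S≡ e₀₁ =
      inducedIsoTo-intro G H S (a ∷ b ∷ []) (injective , (λ y → trans (S≡ y) (sym (image₂ a b y))) , edges)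
      where
      injective : ∀ i j → ((lookup (a ∷ b ∷ []) i ==ᶠ lookup (a ∷ b ∷ []) j) ⇒ᵇ (i ==ᶠ j)) ≡ true
      injective 0F 0F = ⇒ᵇ-true _
      injective 0F 1F = ≢⇒⇒ᵇ a≢b
      injective 1F 0F = ≢⇒⇒ᵇ (λ p → a≢b (sym p))
      injective 1F 1F = ⇒ᵇ-true _
      edges : ∀ i j → adj G (lookup (a ∷ b ∷ []) i) (lookup (a ∷ b ∷ []) j) ≡ adj H i j
      edges 0F 0F = adj-diag H a 0F
      edges 0F 1F = e₀₁
      edges 1F 0F = adj-flip H e₀₁
      edges 1F 1F = adj-diag H b 1F

    inducedIsoTo₂-elim : (H : SimpleGraph 2) (S : Subset n) → inducedIsoTo G H S ≡ true →
      Σ[ a ∈ Fin n ] Σ[ b ∈ Fin n ] (a ≢ b × (∀ y → lookup S y ≡ inPair a b y) × adj G a b ≡ adj H 0F 1F)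
    inducedIsoTo₂-elim H S h with inducedIsoTo-elim G H S h
    ... | (a ∷ b ∷ []) , injective , image , edges =
      a , b , ⇒ᵇ-false⇒≢ (injective 0F 1F) , (λ y → trans (image y) (image₂ a b y)) , edges 0F 1F

    inducedIsoTo₃-intro : (H : SimpleGraph 3) (S : Subset n) (a b c : Fin n) → a ≢ b → a ≢ c → b ≢ c →
      (∀ y → lookup S y ≡ inTriple a b c y) →
      adj G a b ≡ adj H 0F 1F → adj G a c ≡ adj H 0F 2F → adj G b c ≡ adj H 1F 2F → inducedIsoTo G H S ≡ true
    inducedIsoTo₃-intro H S a b c a≢b a≢c b≢c S≡ e₀₁ e₀₂ e₁₂ =
      inducedIsoTo-intro G H S (a ∷ b ∷ c ∷ []) (injective , (λ y → trans (S≡ y) (sym (image₃ a b c y))) , edges)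
      where
      injective : ∀ i j → ((lookup (a ∷ b ∷ c ∷ []) i ==ᶠ lookup (a ∷ b ∷ c ∷ []) j) ⇒ᵇ (i ==ᶠ j)) ≡ true
      injective 0F 0F = ⇒ᵇ-true _
      injective 0F 1F = ≢⇒⇒ᵇ a≢b
      injective 0F 2F = ≢⇒⇒ᵇ a≢c
      injective 1F 0F = ≢⇒⇒ᵇ (λ p → a≢b (sym p))
      injective 1F 1F = ⇒ᵇ-true _
      injective 1F 2F = ≢⇒⇒ᵇ b≢c
      injective 2F 0F = ≢⇒⇒ᵇ (λ p → a≢c (sym p))
      injective 2F 1F = ≢⇒⇒ᵇ (λ p → b≢c (sym p))
      injective 2F 2F = ⇒ᵇ-true _
      edges : ∀ i j → adj G (lookup (a ∷ b ∷ c ∷ []) i) (lookup (a ∷ b ∷ c ∷ []) j) ≡ adj H i j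
      edges 0F 0F = adj-diag H a 0F
      edges 0F 1F = e₀₁
      edges 0F 2F = e₀₂
      edges 1F 0F = adj-flip H e₀₁
      edges 1F 1F = adj-diag H b 1F
      edges 1F 2F = e₁₂
      edges 2F 0F = adj-flip H e₀₂
      edges 2F 1F = adj-flip H e₁₂
      edges 2F 2F = adj-diag H c 2F

    inducedIsoTo₃-elim : (H : SimpleGraph 3) (S : Subset n) → inducedIsoTo G H S ≡ true →
      Σ[ a ∈ Fin n ] Σ[ b ∈ Fin n ] Σ[ c ∈ Fin n ] ((a ≢ b × a ≢ c × b ≢ c) × (∀ y → lookup S y ≡ inTriple a b c y) ×
        (adj G a b ≡ adj H 0F 1F × adj G a c ≡ adj H 0F 2F × adj G b c ≡ adj H 1F 2F))
    inducedIsoTo₃-elim H S h with inducedIsoTo-elim G H S h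
    ... | (a ∷ b ∷ c ∷ []) , injective , image , edges =
      a , b , c , (⇒ᵇ-false⇒≢ (injective 0F 1F) , ⇒ᵇ-false⇒≢ (injective 0F 2F) , ⇒ᵇ-false⇒≢ (injective 1F 2F))
        , (λ y → trans (image y) (image₃ a b c y)) , (edges 0F 1F , edges 0F 2F , edges 1F 2F)

  module _ {n : ℕ} (G : SimpleGraph n) where

    centre-walk : (M : Fin n → Bool) (b : Fin n) → (∀ t → M t ≡ true → t ≡ b ⊎ adj G b t ≡ true) →
                  ∀ r t → M r ≡ true → M t ≡ true → walkWithin G 2 r t ≡ true
    centre-walk M b star r t r∈M t∈M = second (star t t∈M)
      where
      first : walkWithin G 1 r b ≡ true
      first with star r r∈M
      ... | inj₁ refl = walkWithin-refl G 1 r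
      ... | inj₂ b~r  = walkWithin-step G 0 (walkWithin-refl G 0 r) (trans (SimpleGraph.sym G r b) b~r)
      second : t ≡ b ⊎ adj G b t ≡ true → walkWithin G 2 r t ≡ true
      second (inj₁ refl) = ∨-introˡ _ first
      second (inj₂ b~t)  = walkWithin-step G 1 first b~t

    centre₃ : ∀ a b c → adj G b a ≡ true → adj G b c ≡ true → ∀ t → inTriple a b c t ≡ true → t ≡ b ⊎ adj G b t ≡ true
    centre₃ a b c b~a b~c t t∈ with inTriple-cases a b c t t∈
    ... | inj₁ refl        = inj₂ b~a
    ... | inj₂ (inj₁ refl) = inj₁ refl
    ... | inj₂ (inj₂ refl) = inj₂ b~c

    -- Inside a component, any neighbour of a member is reachable from the root, hence a member.
    component-closed : (S : Subset n) (M : Fin n → Bool) (k : ℕ) → suc k ≤ n → (∀ y → lookup S y ≡ M y) →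
      (∀ r t → M r ≡ true → M t ≡ true → walkWithin G k r t ≡ true) →
      isComponent G S ≡ true → ∀ t y → M t ≡ true → adj G t y ≡ true → M y ≡ true
    component-closed S M k k<n S≡M walks component t y t∈M t~y with r , r∈S , S≡reach ← isComponent-elim G S component =
      trans (sym (S≡M y)) (trans (S≡reach y)
        (walkWithin-mono G k<n (walkWithin-step G k (walks r t (trans (sym (S≡M r)) r∈S) t∈M) t~y)))

    trapped-intro : ∀ x a b → (∀ y → adj G x y ≡ true → inTriple x a b y ≡ true) → trapped G x a b ≡ true
    trapped-intro x a b h = all⇒ᵇ-intro (inPair a b) (adj G x) within
      where
      within : ∀ y → adj G x y ≡ true → inPair a b y ≡ true
      within y x~y = trans (sym (cong (_∨ inPair a b y) (≢⇒==ᶠ-false (adj⇒≢ G x~y)))) (h y x~y)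

    closedTriple-intro : ∀ u v w → (∀ t y → inTriple u v w t ≡ true → adj G t y ≡ true → inTriple u v w y ≡ true) →
                         closedTriple G u v w ≡ true
    closedTriple-intro u v w h =
      ∧-intro (trapped-intro u v w (λ y e → h u y (inTriple-₁ u v w) e))
      (∧-intro (trapped-intro v u w (λ y e → trans (inTriple-swap₁₂ u v w y) (h v y (inTriple-₂ u v w) e)))
               (trapped-intro w u v (λ y e → trans (inTriple-rotate u v w y) (h w y (inTriple-₃ u v w) e))))

    closedTriple-elim : ∀ u v w → closedTriple G u v w ≡ true →
                        ∀ t y → inTriple u v w t ≡ true → adj G t y ≡ true → inTriple u v w y ≡ true
    closedTriple-elim u v w h t y t∈ t~y with inTriple-cases u v w t t∈
    ... | inj₁ refl =
      ∨-introʳ (y ==ᶠ t) (all⇒ᵇ-elim (inPair v w) (adj G t) (∧-conicalˡ _ _ h) y t~y)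
    ... | inj₂ (inj₁ refl) = trans (sym (inTriple-swap₁₂ u t w y))
      (∨-introʳ (y ==ᶠ t) (all⇒ᵇ-elim (inPair u w) (adj G t) (∧-conicalˡ _ _ (∧-conicalʳ (trapped G u t w) _ h)) y t~y))
    ... | inj₂ (inj₂ refl) = trans (sym (inTriple-rotate u v t y))
      (∨-introʳ (y ==ᶠ t) (all⇒ᵇ-elim (inPair u v) (adj G t)
                                      (∧-conicalʳ (trapped G v u t) _ (∧-conicalʳ (trapped G u v t) _ h)) y t~y))

    tripleSet-component : ∀ u v w a b c → u ≢ v → u ≢ w → v ≢ w → (∀ y → inTriple u v w y ≡ inTriple a b c y) →
      adj G b a ≡ true → adj G b c ≡ true → closedTriple G u v w ≡ true → isComponent G (tripleSet u v w) ≡ true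
    tripleSet-component u v w a b c u≢v u≢w v≢w same b~a b~c closed =
      isComponent-intro G (tripleSet u v w) u (trans (lookup∘tabulate _ u) (inTriple-₁ u v w))
        (λ y y∈ → walkWithin-mono G (≤-trans (s≤s (s≤s (z≤n {1}))) (distinct⇒3≤n u≢v u≢w v≢w))
                    (centre-walk (inTriple a b c) b (centre₃ a b c b~a b~c) u y
                       (trans (sym (same u)) (inTriple-₁ u v w)) (trans (sym (same y)) (trans (sym (lookup∘tabulate _ y)) y∈))))
        (λ t y t∈ t~y → trans (lookup∘tabulate _ y)
                            (closedTriple-elim u v w closed t y (trans (sym (lookup∘tabulate _ t)) t∈) t~y))

  data Perm₃ {n} (u v w : Fin n) : Fin n → Fin n → Fin n → Set where
    uvw : Perm₃ u v w u v w
    uwv : Perm₃ u v w u w v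
    vuw : Perm₃ u v w v u w
    vwu : Perm₃ u v w v w u
    wuv : Perm₃ u v w w u v
    wvu : Perm₃ u v w w v u

  perm₃ : ∀ {n} (u v w a b c : Fin n) → inTriple u v w a ≡ true → inTriple u v w b ≡ true → inTriple u v w c ≡ true →
          a ≢ b → a ≢ c → b ≢ c → Perm₃ u v w a b c
  perm₃ u v w a b c a∈ b∈ c∈ a≢b a≢c b≢c with inTriple-cases u v w a a∈ | inTriple-cases u v w b b∈ | inTriple-cases u v w c c∈
  ... | inj₁ refl        | inj₁ refl        | _                = ⊥-elim (a≢b refl)
  ... | inj₁ refl        | _                | inj₁ refl        = ⊥-elim (a≢c refl)
  ... | _                | inj₁ refl        | inj₁ refl        = ⊥-elim (b≢c refl)
  ... | inj₂ (inj₁ refl) | inj₂ (inj₁ refl) | _                = ⊥-elim (a≢b refl)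
  ... | inj₂ (inj₁ refl) | _                | inj₂ (inj₁ refl) = ⊥-elim (a≢c refl)
  ... | _                | inj₂ (inj₁ refl) | inj₂ (inj₁ refl) = ⊥-elim (b≢c refl)
  ... | inj₂ (inj₂ refl) | inj₂ (inj₂ refl) | _                = ⊥-elim (a≢b refl)
  ... | inj₂ (inj₂ refl) | _                | inj₂ (inj₂ refl) = ⊥-elim (a≢c refl)
  ... | _                | inj₂ (inj₂ refl) | inj₂ (inj₂ refl) = ⊥-elim (b≢c refl)
  ... | inj₁ refl        | inj₂ (inj₁ refl) | inj₂ (inj₂ refl) = uvw
  ... | inj₁ refl        | inj₂ (inj₂ refl) | inj₂ (inj₁ refl) = uwv
  ... | inj₂ (inj₁ refl) | inj₁ refl        | inj₂ (inj₂ refl) = vuw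
  ... | inj₂ (inj₁ refl) | inj₂ (inj₂ refl) | inj₁ refl        = vwu
  ... | inj₂ (inj₂ refl) | inj₁ refl        | inj₂ (inj₁ refl) = wuv
  ... | inj₂ (inj₂ refl) | inj₂ (inj₁ refl) | inj₁ refl        = wvu

  module _ {n : ℕ} (G : SimpleGraph n) where

    private
      flip : ∀ {x y} {b} → adj G x y ≡ b → adj G y x ≡ b
      flip {x} {y} e = trans (SimpleGraph.sym G y x) e

    path⇒twoEdges : ∀ {u v w a b c} → Perm₃ u v w a b c → adj G a b ≡ true → adj G a c ≡ false → adj G b c ≡ true →
                    twoEdges G u v w ≡ true
    path⇒twoEdges uvw ab ac bc rewrite ab | ac | bc = refl
    path⇒twoEdges uwv ab ac bc rewrite ab | ac | flip bc = refl
    path⇒twoEdges vuw ab ac bc rewrite flip ab | ac | bc = refl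
    path⇒twoEdges vwu ab ac bc rewrite ab | flip ac | flip bc = refl
    path⇒twoEdges wuv ab ac bc rewrite flip ab | flip ac | bc = refl
    path⇒twoEdges wvu ab ac bc rewrite flip ab | flip ac | flip bc = refl

    triangle⇒edges : ∀ {u v w a b c} → Perm₃ u v w a b c → adj G a b ≡ true → adj G a c ≡ true → adj G b c ≡ true →
                     (adj G u v ∧ adj G u w ∧ adj G v w) ≡ true
    triangle⇒edges uvw ab ac bc rewrite ab | ac | bc = refl
    triangle⇒edges uwv ab ac bc rewrite ab | ac | flip bc = refl
    triangle⇒edges vuw ab ac bc rewrite flip ab | ac | bc = refl
    triangle⇒edges vwu ab ac bc rewrite ab | flip ac | flip bc = refl
    triangle⇒edges wuv ab ac bc rewrite flip ab | flip ac | bc = refl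
    triangle⇒edges wvu ab ac bc rewrite flip ab | flip ac | flip bc = refl

    component₃-elim : (H : SimpleGraph 3) → adj H 1F 0F ≡ true → adj H 1F 2F ≡ true → ∀ u v w → u ≢ v → u ≢ w → v ≢ w →
      (isComponent G (tripleSet u v w) ∧ inducedIsoTo G H (tripleSet u v w)) ≡ true →
      closedTriple G u v w ≡ true × Σ[ a ∈ Fin n ] Σ[ b ∈ Fin n ] Σ[ c ∈ Fin n ]
        (Perm₃ u v w a b c × adj G a b ≡ adj H 0F 1F × adj G a c ≡ adj H 0F 2F × adj G b c ≡ adj H 1F 2F)
    component₃-elim H h₁₀ h₁₂ u v w u≢v u≢w v≢w h
      with a , b , c , (a≢b , a≢c , b≢c) , S≡ , (e₀₁ , e₀₂ , e₁₂) ← inducedIsoTo₃-elim G H (tripleSet u v w) (∧-conicalʳ _ _ h) =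
      closed , a , b , c , perm , e₀₁ , e₀₂ , e₁₂
      where
      same : ∀ y → inTriple u v w y ≡ inTriple a b c y
      same y = trans (sym (lookup∘tabulate _ y)) (S≡ y)
      b~a : adj G b a ≡ true
      b~a = trans (SimpleGraph.sym G b a) (trans e₀₁ (trans (SimpleGraph.sym H 0F 1F) h₁₀))
      closed-abc : ∀ t y → inTriple a b c t ≡ true → adj G t y ≡ true → inTriple a b c y ≡ true
      closed-abc = component-closed G (tripleSet u v w) (inTriple a b c) 2 (distinct⇒3≤n u≢v u≢w v≢w) S≡
                     (centre-walk G (inTriple a b c) b (centre₃ G a b c b~a (trans e₁₂ h₁₂))) (∧-conicalˡ _ _ h)
      closed : closedTriple G u v w ≡ true
      closed = closedTriple-intro G u v w (λ t y t∈ t~y → trans (same y) (closed-abc t y (trans (sym (same t)) t∈) t~y))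
      perm : Perm₃ u v w a b c
      perm = perm₃ u v w a b c (trans (same a) (inTriple-₁ a b c)) (trans (same b) (inTriple-₂ a b c))
                               (trans (same c) (inTriple-₃ a b c)) a≢b a≢c b≢c

    isP3-component : ∀ u v w → u ≢ v → u ≢ w → v ≢ w →
      (isComponent G (tripleSet u v w) ∧ inducedIsoTo G P₃ (tripleSet u v w)) ≡ isP3 G u v w
    isP3-component u v w u≢v u≢w v≢w = ⇔→≡ (mk⇔ to from)
      where
      Component = (isComponent G (tripleSet u v w) ∧ inducedIsoTo G P₃ (tripleSet u v w)) ≡ true

      to : Component → isP3 G u v w ≡ true
      to h = edges (component₃-elim P₃ refl refl u v w u≢v u≢w v≢w h)
        where
        edges : closedTriple G u v w ≡ true × Σ[ a ∈ Fin n ] Σ[ b ∈ Fin n ] Σ[ c ∈ Fin n ]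
                  (Perm₃ u v w a b c × adj G a b ≡ true × adj G a c ≡ false × adj G b c ≡ true) → isP3 G u v w ≡ true
        edges (closed , a , b , c , perm , e₀₁ , e₀₂ , e₁₂) = ∧-intro closed (path⇒twoEdges perm e₀₁ e₀₂ e₁₂)

      from : isP3 G u v w ≡ true → Component
      from h = ∨-elim₃ (∧-conicalʳ (closedTriple G u v w) _ h) centre-v centre-u centre-w
        where
        closed : closedTriple G u v w ≡ true
        closed = ∧-conicalˡ _ _ h

        centre-v : (adj G u v ∧ adj G v w ∧ not (adj G u w)) ≡ true → Component
        centre-v p = ∧-intro (tripleSet-component G u v w u v w u≢v u≢w v≢w (λ _ → refl) (flip uv) vw closed)
                             (inducedIsoTo₃-intro G P₃ (tripleSet u v w) u v w u≢v u≢w v≢w (lookup∘tabulate _) uv ¬uw vw)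
          where
          uv : adj G u v ≡ true
          uv = ∧-conicalˡ _ _ p
          vw : adj G v w ≡ true
          vw = ∧-conicalˡ _ _ (∧-conicalʳ (adj G u v) _ p)
          ¬uw : adj G u w ≡ false
          ¬uw = not-injective (∧-conicalʳ (adj G v w) _ (∧-conicalʳ (adj G u v) _ p))

        centre-u : (adj G u v ∧ adj G u w ∧ not (adj G v w)) ≡ true → Component
        centre-u p = ∧-intro (tripleSet-component G u v w v u w u≢v u≢w v≢w (λ y → sym (inTriple-swap₁₂ u v w y)) uv uw closed)
                             (inducedIsoTo₃-intro G P₃ (tripleSet u v w) v u w (λ q → u≢v (sym q)) v≢w u≢w
                                (λ y → trans (lookup∘tabulate _ y) (sym (inTriple-swap₁₂ u v w y))) (flip uv) ¬vw uw)
          where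
          uv : adj G u v ≡ true
          uv = ∧-conicalˡ _ _ p
          uw : adj G u w ≡ true
          uw = ∧-conicalˡ _ _ (∧-conicalʳ (adj G u v) _ p)
          ¬vw : adj G v w ≡ false
          ¬vw = not-injective (∧-conicalʳ (adj G u w) _ (∧-conicalʳ (adj G u v) _ p))

        centre-w : (adj G u w ∧ adj G v w ∧ not (adj G u v)) ≡ true → Component
        centre-w p = ∧-intro (tripleSet-component G u v w u w v u≢v u≢w v≢w (λ y → sym (inTriple-swap₂₃ u v w y))
                                                  (flip uw) (flip vw) closed)
                             (inducedIsoTo₃-intro G P₃ (tripleSet u v w) u w v u≢w u≢v (λ q → v≢w (sym q))
                                (λ y → trans (lookup∘tabulate _ y) (sym (inTriple-swap₂₃ u v w y))) uw ¬uv (flip vw))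
          where
          uw : adj G u w ≡ true
          uw = ∧-conicalˡ _ _ p
          vw : adj G v w ≡ true
          vw = ∧-conicalˡ _ _ (∧-conicalʳ (adj G u w) _ p)
          ¬uv : adj G u v ≡ false
          ¬uv = not-injective (∧-conicalʳ (adj G v w) _ (∧-conicalʳ (adj G u w) _ p))

    isK3-component : ∀ u v w → u ≢ v → u ≢ w → v ≢ w →
      (isComponent G (tripleSet u v w) ∧ inducedIsoTo G K₃ (tripleSet u v w)) ≡ isK3 G u v w
    isK3-component u v w u≢v u≢w v≢w = ⇔→≡ (mk⇔ to from)
      where
      Component = (isComponent G (tripleSet u v w) ∧ inducedIsoTo G K₃ (tripleSet u v w)) ≡ true

      to : Component → isK3 G u v w ≡ true
      to h = edges (component₃-elim K₃ refl refl u v w u≢v u≢w v≢w h)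
        where
        edges : closedTriple G u v w ≡ true × Σ[ a ∈ Fin n ] Σ[ b ∈ Fin n ] Σ[ c ∈ Fin n ]
                  (Perm₃ u v w a b c × adj G a b ≡ true × adj G a c ≡ true × adj G b c ≡ true) → isK3 G u v w ≡ true
        edges (closed , a , b , c , perm , e₀₁ , e₀₂ , e₁₂) = ∧-intro closed (triangle⇒edges perm e₀₁ e₀₂ e₁₂)

      from : isK3 G u v w ≡ true → Component
      from h = ∧-intro (tripleSet-component G u v w u v w u≢v u≢w v≢w (λ _ → refl) (flip uv) vw closed)
                       (inducedIsoTo₃-intro G K₃ (tripleSet u v w) u v w u≢v u≢w v≢w (lookup∘tabulate _) uv uw vw)
        where
        closed : closedTriple G u v w ≡ true
        closed = ∧-conicalˡ _ _ h
        edges : (adj G u v ∧ adj G u w ∧ adj G v w) ≡ true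
        edges = ∧-conicalʳ (closedTriple G u v w) _ h
        uv : adj G u v ≡ true
        uv = ∧-conicalˡ _ _ edges
        uw : adj G u w ≡ true
        uw = ∧-conicalˡ _ _ (∧-conicalʳ (adj G u v) _ edges)
        vw : adj G v w ≡ true
        vw = ∧-conicalʳ (adj G u w) _ (∧-conicalʳ (adj G u v) _ edges)

  module _ {n : ℕ} (G : SimpleGraph n) where

    private
      flip : ∀ {x y} {b} → adj G x y ≡ b → adj G y x ≡ b
      flip {x} {y} e = trans (SimpleGraph.sym G y x) e

    closedPair⇒leaf : ∀ {p q} → adj G p q ≡ true → (∀ z → adj G p z ≡ true → inPair p q z ≡ true) → isLeaf G p ≡ true
    closedPair⇒leaf {p} {q} p~q closed =
      cong (_≡ᵇ 1) (trans (degree≡card G p) (trans (card-cong only-q) (card-≡ q)))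
      where
      only-q : ∀ z → adj G p z ≡ (z ==ᶠ q)
      only-q z = ⇔→≡ (mk⇔ (λ p~z → [ (λ z≡p → ⊥-elim (adj⇒≢ G p~z z≡p)) , ≡⇒==ᶠ ]′ (inPair-cases p q z (closed z p~z)))
                           (λ z≡q → subst (λ t → adj G p t ≡ true) (sym (==ᶠ⇒≡ z≡q)) p~q))

    isK2-component : ∀ x y → x ≢ y → (isComponent G (pairSet x y) ∧ inducedIsoTo G K₂ (pairSet x y)) ≡ isK2 G x y
    isK2-component x y x≢y = ⇔→≡ (mk⇔ to from)
      where
      Component = (isComponent G (pairSet x y) ∧ inducedIsoTo G K₂ (pairSet x y)) ≡ true

      to : Component → isK2 G x y ≡ true
      to h = edge (inducedIsoTo₂-elim G K₂ (pairSet x y) (∧-conicalʳ (isComponent G (pairSet x y)) _ h))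
        where
        edge : Σ[ a ∈ Fin n ] Σ[ b ∈ Fin n ] (a ≢ b × (∀ z → lookup (pairSet x y) z ≡ inPair a b z) × adj G a b ≡ true) →
               isK2 G x y ≡ true
        edge (a , b , a≢b , S≡ , a~b) = ∧-intro x~y (∧-intro (closedPair⇒leaf x~y closed-x) (closedPair⇒leaf (flip x~y) closed-y))
          where
          walks : ∀ r t → inPair a b r ≡ true → inPair a b t ≡ true → walkWithin G 1 r t ≡ true
          walks r t r∈ t∈ with inPair-cases a b r r∈ | inPair-cases a b t t∈
          ... | inj₁ refl | inj₁ refl = walkWithin-refl G 1 r
          ... | inj₁ refl | inj₂ refl = walkWithin-step G 0 (walkWithin-refl G 0 r) a~b
          ... | inj₂ refl | inj₁ refl = walkWithin-step G 0 (walkWithin-refl G 0 r) (flip a~b)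
          ... | inj₂ refl | inj₂ refl = walkWithin-refl G 1 r
          same : ∀ z → inPair x y z ≡ inPair a b z
          same z = trans (sym (lookup∘tabulate _ z)) (S≡ z)
          closed : ∀ t z → inPair x y t ≡ true → adj G t z ≡ true → inPair x y z ≡ true
          closed t z t∈ t~z = trans (same z) (component-closed G (pairSet x y) (inPair a b) 1 (distinct⇒2≤n a≢b) S≡ walks
                                                 (∧-conicalˡ _ _ h) t z (trans (sym (same t)) t∈) t~z)
          closed-x : ∀ z → adj G x z ≡ true → inPair x y z ≡ true
          closed-x z = closed x z (inPair-₁ x y)
          closed-y : ∀ z → adj G y z ≡ true → inPair y x z ≡ true
          closed-y z y~z = trans (∨-comm (z ==ᶠ y) (z ==ᶠ x)) (closed y z (inPair-₂ x y) y~z)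
          x~y : adj G x y ≡ true
          x~y with inPair-cases x y a (trans (same a) (inPair-₁ a b)) | inPair-cases x y b (trans (same b) (inPair-₂ a b))
          ... | inj₁ refl | inj₁ refl = ⊥-elim (a≢b refl)
          ... | inj₁ refl | inj₂ refl = a~b
          ... | inj₂ refl | inj₁ refl = flip a~b
          ... | inj₂ refl | inj₂ refl = ⊥-elim (a≢b refl)

      from : isK2 G x y ≡ true → Component
      from h = ∧-intro (isComponent-intro G (pairSet x y) x (trans (lookup∘tabulate _ x) (inPair-₁ x y)) reach closed)
                       (inducedIsoTo₂-intro G K₂ (pairSet x y) x y x≢y (lookup∘tabulate _) x~y)
        where
        x~y : adj G x y ≡ true
        x~y = ∧-conicalˡ _ _ h
        x-leaf : ∀ z → adj G x z ≡ (z ==ᶠ y)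
        x-leaf = leaf⇒adj G (∧-conicalˡ _ _ (∧-conicalʳ (adj G x y) _ h)) x~y
        y-leaf : ∀ z → adj G y z ≡ (z ==ᶠ x)
        y-leaf = leaf⇒adj G (∧-conicalʳ (isLeaf G x) _ (∧-conicalʳ (adj G x y) _ h)) (flip x~y)
        reach : ∀ z → lookup (pairSet x y) z ≡ true → reachable G x z ≡ true
        reach z z∈ with inPair-cases x y z (trans (sym (lookup∘tabulate _ z)) z∈)
        ... | inj₁ refl = walkWithin-refl G n z
        ... | inj₂ refl = walkWithin-mono G (≤-trans (s≤s z≤n) (distinct⇒2≤n x≢y)) (walkWithin-step G 0 (walkWithin-refl G 0 x) x~y)
        closed : ∀ t z → lookup (pairSet x y) t ≡ true → adj G t z ≡ true → lookup (pairSet x y) z ≡ true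
        closed t z t∈ t~z with inPair-cases x y t (trans (sym (lookup∘tabulate _ t)) t∈)
        ... | inj₁ refl = trans (lookup∘tabulate _ z) (∨-introʳ (z ==ᶠ t) (trans (sym (x-leaf z)) t~z))
        ... | inj₂ refl = trans (lookup∘tabulate _ z) (∨-introˡ _ (trans (sym (y-leaf z)) t~z))

    ∣∣≡2 : (H : SimpleGraph 2) (S : Subset n) → inducedIsoTo G H S ≡ true → ∣ S ∣ ≡ 2
    ∣∣≡2 H S h = size (inducedIsoTo₂-elim G H S h)
      where
      size : Σ[ a ∈ Fin n ] Σ[ b ∈ Fin n ] (a ≢ b × (∀ y → lookup S y ≡ inPair a b y) × adj G a b ≡ adj H 0F 1F) → ∣ S ∣ ≡ 2
      size (a , b , a≢b , S≡ , _) = trans (∣∣≡card S) (trans (card-cong S≡) (card-pair a b a≢b))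

    ∣∣≡3 : (H : SimpleGraph 3) (S : Subset n) → inducedIsoTo G H S ≡ true → ∣ S ∣ ≡ 3
    ∣∣≡3 H S h = size (inducedIsoTo₃-elim G H S h)
      where
      size : Σ[ a ∈ Fin n ] Σ[ b ∈ Fin n ] Σ[ c ∈ Fin n ] ((a ≢ b × a ≢ c × b ≢ c) × (∀ y → lookup S y ≡ inTriple a b c y) ×
               (adj G a b ≡ adj H 0F 1F × adj G a c ≡ adj H 0F 2F × adj G b c ≡ adj H 1F 2F)) → ∣ S ∣ ≡ 3
      size (a , b , c , (a≢b , a≢c , b≢c) , S≡ , _) = trans (∣∣≡card S) (trans (card-cong S≡) (card-inTriple a b c a≢b a≢c b≢c))

    private
      sized : ∀ {m} (H : SimpleGraph m) k → (∀ S → inducedIsoTo G H S ≡ true → ∣ S ∣ ≡ k) → ∀ S →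
              (isComponent G S ∧ inducedIsoTo G H S) ≡ ((∣ S ∣ ≡ᵇ k) ∧ (isComponent G S ∧ inducedIsoTo G H S))
      sized H k size S = ⇔→≡ (mk⇔ (λ h → ∧-intro (≡⇒≡ᵇ-true (size S (∧-conicalʳ (isComponent G S) _ h))) h)
                                  (∧-conicalʳ (∣ S ∣ ≡ᵇ k) _))

    componentsIsoTo₂ : (H : SimpleGraph 2) (Q : Fin n → Fin n → Bool) →
      (∀ x y → x ≢ y → (isComponent G (pairSet x y) ∧ inducedIsoTo G H (pairSet x y)) ≡ Q x y) →
      componentsIsoTo G H ≡ sumPairs (λ x y → Q x y · 1)
    componentsIsoTo₂ H Q char =
      trans (count-cong (allSubsets n) (sized H 2 (∣∣≡2 H)))
            (trans (count-size≡2 (λ S → isComponent G S ∧ inducedIsoTo G H S))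
                   (sumPairs-cong≢ (λ x y x≢y → cong (_· 1) (char x y x≢y))))

    componentsIsoTo₃ : (H : SimpleGraph 3) (Q : Fin n → Fin n → Fin n → Bool) →
      (∀ u v w → u ≢ v → u ≢ w → v ≢ w → (isComponent G (tripleSet u v w) ∧ inducedIsoTo G H (tripleSet u v w)) ≡ Q u v w) →
      componentsIsoTo G H ≡ sumTriples (λ u v w → Q u v w · 1)
    componentsIsoTo₃ H Q char =
      trans (count-cong (allSubsets n) (sized H 3 (∣∣≡3 H)))
            (trans (count-size≡3 (λ S → isComponent G S ∧ inducedIsoTo G H S))
                   (sumTriples-cong≢ (λ u v w u≢v u≢w v≢w → cong (_· 1) (char u v w u≢v u≢w v≢w))))

    k2Components≡sumPairs : k2Components G ≡ sumPairs (λ x y → isK2 G x y · 1)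
    k2Components≡sumPairs = componentsIsoTo₂ K₂ (isK2 G) isK2-component

    p3Components≡sumTriples : p3Components G ≡ sumTriples (λ u v w → isP3 G u v w · 1)
    p3Components≡sumTriples = componentsIsoTo₃ P₃ (isP3 G) (isP3-component G)

    k3Components≡sumTriples : k3Components G ≡ sumTriples (λ u v w → isK3 G u v w · 1)
    k3Components≡sumTriples = componentsIsoTo₃ K₃ (isK3 G) (isK3-component G)

  -- Counting the trapped vertices of all triples

  module _ {n : ℕ} (G : SimpleGraph n) where

    private
      i = isolatedCount G
      ℓ = leafCount G
      e₂ = k2Components G

    single-traps : sumTriples (λ u v w → trapped G u v w · 1 + trapped G v u w · 1 + trapped G w u v · 1)
                   ≡ i * ((n ∸ 1) C 2) + ℓ * (n ∸ 2) + deg2Count G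
    single-traps = begin
      sumTriples (λ u v w → trapped G u v w · 1 + trapped G v u w · 1 + trapped G w u v · 1)
        ≡⟨ sumTriples-by-apex (λ x y z → trapped G x y z · 1) ⟩
      sum (trapPairs G)
        ≡⟨ sum-cong-≗ (trapPairs-by-degree G) ⟩
      sum (λ x → hasDeg G 0 x · ((n ∸ 1) C 2) + hasDeg G 1 x · (n ∸ 2) + hasDeg G 2 x · 1)
        ≡⟨ ∑-distrib-+ (λ x → hasDeg G 0 x · ((n ∸ 1) C 2) + hasDeg G 1 x · (n ∸ 2)) (λ x → hasDeg G 2 x · 1) ⟩
      sum (λ x → hasDeg G 0 x · ((n ∸ 1) C 2) + hasDeg G 1 x · (n ∸ 2)) + card (hasDeg G 2)
        ≡⟨ cong (_+ card (hasDeg G 2)) (∑-distrib-+ (λ x → hasDeg G 0 x · ((n ∸ 1) C 2)) (λ x → hasDeg G 1 x · (n ∸ 2))) ⟩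
      sum (λ x → hasDeg G 0 x · ((n ∸ 1) C 2)) + sum (λ x → hasDeg G 1 x · (n ∸ 2)) + card (hasDeg G 2)
        ≡⟨ cong₂ _+_ (cong₂ _+_ (sum-·-card (hasDeg G 0) _) (sum-·-card (hasDeg G 1) _)) refl ⟩
      card (hasDeg G 0) * ((n ∸ 1) C 2) + card (hasDeg G 1) * (n ∸ 2) + card (hasDeg G 2)
        ≡⟨ sym (cong₂ _+_ (cong₂ _+_ (cong (_* _) (count-allFin (hasDeg G 0))) (cong (_* _) (count-allFin (hasDeg G 1))))
                          (count-allFin (hasDeg G 2))) ⟩
      i * ((n ∸ 1) C 2) + ℓ * (n ∸ 2) + deg2Count G ∎
      where open ≡-Reasoning

    triple-traps : sumTriples (λ u v w → closedTriple G u v w · 1) ≡ i C 3 + i * e₂ + p3Components G + k3Components G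
    triple-traps = begin
      sumTriples (λ u v w → closedTriple G u v w · 1)
        ≡⟨ sumTriples-cong≢ (closedTriple-split G) ⟩
      sumTriples (λ u v w → X₁ u v w + X₂ u v w + X₃ u v w + X₄ u v w)
        ≡⟨ sumTriples-+ (λ u v w → X₁ u v w + X₂ u v w + X₃ u v w) X₄ ⟩
      sumTriples (λ u v w → X₁ u v w + X₂ u v w + X₃ u v w) + sumTriples X₄
        ≡⟨ cong (_+ sumTriples X₄) (sumTriples-+ (λ u v w → X₁ u v w + X₂ u v w) X₃) ⟩
      sumTriples (λ u v w → X₁ u v w + X₂ u v w) + sumTriples X₃ + sumTriples X₄
        ≡⟨ cong (λ t → t + sumTriples X₃ + sumTriples X₄) (sumTriples-+ X₁ X₂) ⟩
      sumTriples X₁ + sumTriples X₂ + sumTriples X₃ + sumTriples X₄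
        ≡⟨ cong₂ _+_ (cong₂ _+_ (cong₂ _+_
             (trans (sumTriples-C3 (isIsolated G)) (cong (_C 3) (sym (count-allFin (hasDeg G 0)))))
             (trans (sumTriples-vertex-and-pair (isIsolated G) (isK2 G) isolated-first isolated-second)
                    (cong₂ _*_ (sym (count-allFin (hasDeg G 0))) (sym (k2Components≡sumPairs G)))))
             (sym (p3Components≡sumTriples G)))
             (sym (k3Components≡sumTriples G)) ⟩
      i C 3 + i * e₂ + p3Components G + k3Components G ∎
      where
      open ≡-Reasoning
      X₁ X₂ X₃ X₄ : Fin n → Fin n → Fin n → ℕ
      X₁ u v w = (isIsolated G u ∧ isIsolated G v ∧ isIsolated G w) · 1
      X₂ u v w = isolatedAndK2 G u v w · 1
      X₃ u v w = isP3 G u v w · 1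
      X₄ u v w = isK3 G u v w · 1
      isolated-first : ∀ x y → isIsolated G x ≡ true → isK2 G x y ≡ false
      isolated-first x y h = cong (_∧ (isLeaf G x ∧ isLeaf G y)) (isolated⇒¬adj G h y)
      isolated-second : ∀ x y → isIsolated G x ≡ true → isK2 G y x ≡ false
      isolated-second x y h = cong (_∧ (isLeaf G y ∧ isLeaf G x)) (trans (SimpleGraph.sym G y x) (isolated⇒¬adj G h y))

    double-traps : sumTriples (λ u v w → (trapped G u v w ∧ trapped G v u w) · 1 + (trapped G u v w ∧ trapped G w u v) · 1
                                         + (trapped G v u w ∧ trapped G w u v) · 1)
                 ≡ (i C 2) * (n ∸ 2) + i * ℓ + e₂ * (n ∸ 2) + leafPairCommonNbr G + leafDeg2Edges G + deg2PairsSameClosedNbr G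
    double-traps = begin
      sumTriples (λ u v w → (trapped G u v w ∧ trapped G v u w) · 1 + (trapped G u v w ∧ trapped G w u v) · 1
                            + (trapped G v u w ∧ trapped G w u v) · 1)
        ≡⟨ sumTriples-cong (λ u v w → cong₂ _+_ (cong₂ _+_ refl (cong (λ t → (t ∧ trapped G w u v) · 1) (trapped-sym G u v w)))
                                                (cong₂ (λ s t → (s ∧ t) · 1) (trapped-sym G v u w) (trapped-sym G w u v))) ⟩
      sumTriples (λ u v w → joint u v w + joint u w v + joint v w u)
        ≡⟨ sumTriples-by-pair joint ⟩
      sumPairs (jointTraps G)
        ≡⟨ sumPairs-cong≢ (jointTraps≡pairWeight G) ⟩
      sumPairs (λ x y → Y₁ x y + Y₂ x y + Y₃ x y + Y₄ x y + Y₅ x y + Y₆ x y)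
        ≡⟨ trans (sumPairs-+ _ Y₆) (cong (_+ sumPairs Y₆)
           (trans (sumPairs-+ _ Y₅) (cong (_+ sumPairs Y₅)
           (trans (sumPairs-+ _ Y₄) (cong (_+ sumPairs Y₄)
           (trans (sumPairs-+ _ Y₃) (cong (_+ sumPairs Y₃) (sumPairs-+ Y₁ Y₂)))))))) ⟩
      sumPairs Y₁ + sumPairs Y₂ + sumPairs Y₃ + sumPairs Y₄ + sumPairs Y₅ + sumPairs Y₆
        ≡⟨ cong₂ _+_ (cong₂ _+_ (cong₂ _+_ (cong₂ _+_ (cong₂ _+_
             (trans (sumPairs-·-card (λ x y → hasDeg G 0 x ∧ hasDeg G 0 y) (n ∸ 2))
                    (cong (_* (n ∸ 2)) (trans (sumPairs-C2 (hasDeg G 0)) (cong (_C 2) (sym (count-allFin (hasDeg G 0)))))))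
             (trans (sumPairs-cross (hasDeg G 0) (hasDeg G 1) (λ x → isolated-not-leaf (degree G x)))
                    (cong₂ _*_ (sym (count-allFin (hasDeg G 0))) (sym (count-allFin (hasDeg G 1))))))
             (trans (sumPairs-·-card (isK2 G) (n ∸ 2)) (cong (_* (n ∸ 2)) (sym (k2Components≡sumPairs G)))))
             (sym (pairCount≡sumPairs G _)))
             (sym (pairCount≡sumPairs G _)))
             (sym (pairCount≡sumPairs G _)) ⟩
      (i C 2) * (n ∸ 2) + i * ℓ + e₂ * (n ∸ 2) + leafPairCommonNbr G + leafDeg2Edges G + deg2PairsSameClosedNbr G ∎
      where
      open ≡-Reasoning
      joint : Fin n → Fin n → Fin n → ℕ
      joint x y z = (trapped G x y z ∧ trapped G y x z) · 1
      Y₁ Y₂ Y₃ Y₄ Y₅ Y₆ : Fin n → Fin n → ℕ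
      Y₁ x y = (hasDeg G 0 x ∧ hasDeg G 0 y) · (n ∸ 2)
      Y₂ x y = ((hasDeg G 0 x ∧ hasDeg G 1 y) ∨ (hasDeg G 1 x ∧ hasDeg G 0 y)) · 1
      Y₃ x y = isK2 G x y · (n ∸ 2)
      Y₄ x y = (isLeaf G x ∧ isLeaf G y ∧ commonNbr G x y) · 1
      Y₅ x y = (adj G x y ∧ ((isLeaf G x ∧ isDeg2 G y) ∨ (isDeg2 G x ∧ isLeaf G y))) · 1
      Y₆ x y = (isDeg2 G x ∧ isDeg2 G y ∧ sameClosedNbr G x y) · 1
      isolated-not-leaf : ∀ d → ((d ≡ᵇ 0) ∧ (d ≡ᵇ 1)) ≡ false
      isolated-not-leaf zero    = refl
      isolated-not-leaf (suc d) = refl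

    domCount-identity : domCount G (+ n - + 3) + (i * ((n ∸ 1) C 2) + ℓ * (n ∸ 2) + deg2Count G)
                          + (i C 3 + i * e₂ + p3Components G + k3Components G)
                        ≡ n C 3 + ((i C 2) * (n ∸ 2) + i * ℓ + e₂ * (n ∸ 2) + leafPairCommonNbr G + leafDeg2Edges G
                                   + deg2PairsSameClosedNbr G)
    domCount-identity = begin
      domCount G (+ n - + 3) + (i * ((n ∸ 1) C 2) + ℓ * (n ∸ 2) + deg2Count G) + (i C 3 + i * e₂ + p3Components G + k3Components G)
        ≡⟨ cong₂ _+_ (cong₂ _+_ (domCount≡untrappedTriples n G) (sym single-traps)) (sym triple-traps) ⟩
      sumTriples trapped₀ + sumTriples trapped₁ + sumTriples trapped₃
        ≡⟨ sym (trans (sumTriples-+ (λ u v w → trapped₀ u v w + trapped₁ u v w) trapped₃)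
                      (cong (_+ sumTriples trapped₃) (sumTriples-+ trapped₀ trapped₁))) ⟩
      sumTriples (λ u v w → trapped₀ u v w + trapped₁ u v w + trapped₃ u v w)
        ≡⟨ sumTriples-cong (λ u v w → inclusion-exclusion₃ (trapped G u v w) (trapped G v u w) (trapped G w u v)) ⟩
      sumTriples (λ u v w → 1 + trapped₂ u v w)
        ≡⟨ sumTriples-+ (λ _ _ _ → 1) trapped₂ ⟩
      sumTriples {n} (λ _ _ _ → 1) + sumTriples trapped₂
        ≡⟨ cong₂ _+_ (trans (sumTriples-C3 {n} (λ _ → true)) (cong (_C 3) (card-true {n}))) double-traps ⟩
      n C 3 + ((i C 2) * (n ∸ 2) + i * ℓ + e₂ * (n ∸ 2) + leafPairCommonNbr G + leafDeg2Edges G + deg2PairsSameClosedNbr G) ∎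
      where
      open ≡-Reasoning
      trapped₀ trapped₁ trapped₂ trapped₃ : Fin n → Fin n → Fin n → ℕ
      trapped₀ u v w = (not (trapped G u v w) ∧ not (trapped G v u w) ∧ not (trapped G w u v)) · 1
      trapped₁ u v w = trapped G u v w · 1 + trapped G v u w · 1 + trapped G w u v · 1
      trapped₂ u v w = (trapped G u v w ∧ trapped G v u w) · 1 + (trapped G u v w ∧ trapped G w u v) · 1
                       + (trapped G v u w ∧ trapped G w u v) · 1
      trapped₃ u v w = closedTriple G u v w · 1

open import Data.Integer using (_+_; _*_)
open import Data.Integer.Tactic.RingSolver using (solve-∀)

private
  rearrange : ∀ (d a k c b : ℕ) → d ℕ.+ a ℕ.+ k ≡ c ℕ.+ b → + d ≡ + c - + a + + b - + k
  rearrange d a k c b eq = begin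
    + d                               ≡⟨ cancel (+ d) (+ a) (+ k) ⟩
    + d + + a + + k - + a - + k       ≡⟨ cong (λ t → t - + a - + k)
                                             (trans (cong (_+ + k) (sym (pos-+ d a))) (sym (pos-+ (d ℕ.+ a) k))) ⟩
    + (d ℕ.+ a ℕ.+ k) - + a - + k     ≡⟨ cong (λ t → + t - + a - + k) eq ⟩
    + (c ℕ.+ b) - + a - + k           ≡⟨ cong (λ t → t - + a - + k) (pos-+ c b) ⟩
    + c + + b - + a - + k             ≡⟨ reorder (+ c) (+ a) (+ b) (+ k) ⟩
    + c - + a + + b - + k             ∎
    where
    open ≡-Reasoning
    cancel : ∀ (x y z : ℤ) → x ≡ x + y + z - y - z
    cancel = solve-∀
    reorder : ∀ (x y z w : ℤ) → x + z - y - w ≡ x - y + z - w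
    reorder = solve-∀

  -- + n - + 2 is not + (n ∸ 2) when n ≤ 1, but then the coefficient vanishes.
  +-*-∸2 : ∀ n x → (n ≤ 1 → x ≡ 0) → + (x ℕ.* (n ∸ 2)) ≡ + x * (+ n - + 2)
  +-*-∸2 0 x x≡0 rewrite x≡0 z≤n = refl
  +-*-∸2 1 x x≡0 rewrite x≡0 (s≤s z≤n) = refl
  +-*-∸2 (suc (suc k)) x _ = pos-* x k

  small-leafCount : ∀ n (G : SimpleGraph n) → n ≤ 1 → leafCount G ≡ 0
  small-leafCount 0 G _ = refl
  small-leafCount 1 G _ rewrite SimpleGraph.irrefl G 0F = refl
  small-leafCount (suc (suc _)) G (s≤s ())

  small-isolatedPairs : ∀ n (G : SimpleGraph n) → n ≤ 1 → isolatedCount G C 2 ≡ 0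
  small-isolatedPairs n G n≤1 = C2 (≤-trans (≤-reflexive (count-allFin (hasDeg G 0))) (≤-trans (card-≤ (hasDeg G 0)) n≤1))
    where
    C2 : ∀ {i} → i ≤ 1 → i C 2 ≡ 0
    C2 z≤n       = refl
    C2 (s≤s z≤n) = refl

  small-k2Components : ∀ n (G : SimpleGraph n) → n ≤ 1 → k2Components G ≡ 0
  small-k2Components 0 G _ = k2Components≡sumPairs G
  small-k2Components 1 G _ = k2Components≡sumPairs G
  small-k2Components (suc (suc _)) G (s≤s ())

  singles-ℤ : ∀ n i x ℓ n₂ → (n ≤ 1 → ℓ ≡ 0) → + (i ℕ.* x ℕ.+ ℓ ℕ.* (n ∸ 2) ℕ.+ n₂) ≡ + i * + x + + ℓ * (+ n - + 2) + + n₂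
  singles-ℤ n i x ℓ n₂ ℓ≡0 =
    trans (pos-+ (i ℕ.* x ℕ.+ ℓ ℕ.* (n ∸ 2)) n₂)
          (cong (_+ + n₂) (trans (pos-+ (i ℕ.* x) (ℓ ℕ.* (n ∸ 2))) (cong₂ _+_ (pos-* i x) (+-*-∸2 n ℓ ℓ≡0))))

  pairs-ℤ : ∀ n i₂ i ℓ e₂ s m t → (n ≤ 1 → i₂ ≡ 0) → (n ≤ 1 → e₂ ≡ 0) →
    + (i₂ ℕ.* (n ∸ 2) ℕ.+ i ℕ.* ℓ ℕ.+ e₂ ℕ.* (n ∸ 2) ℕ.+ s ℕ.+ m ℕ.+ t)
    ≡ + i₂ * (+ n - + 2) + + i * + ℓ + + e₂ * (+ n - + 2) + + s + + m + + t
  pairs-ℤ n i₂ i ℓ e₂ s m t i₂≡0 e₂≡0 =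
    trans (pos-+ (i₂ ℕ.* (n ∸ 2) ℕ.+ i ℕ.* ℓ ℕ.+ e₂ ℕ.* (n ∸ 2) ℕ.+ s ℕ.+ m) t) (cong (_+ + t)
    (trans (pos-+ (i₂ ℕ.* (n ∸ 2) ℕ.+ i ℕ.* ℓ ℕ.+ e₂ ℕ.* (n ∸ 2) ℕ.+ s) m) (cong (_+ + m)
    (trans (pos-+ (i₂ ℕ.* (n ∸ 2) ℕ.+ i ℕ.* ℓ ℕ.+ e₂ ℕ.* (n ∸ 2)) s) (cong (_+ + s)
    (trans (pos-+ (i₂ ℕ.* (n ∸ 2) ℕ.+ i ℕ.* ℓ) (e₂ ℕ.* (n ∸ 2)))
           (cong₂ _+_ (trans (pos-+ (i₂ ℕ.* (n ∸ 2)) (i ℕ.* ℓ)) (cong₂ _+_ (+-*-∸2 n i₂ i₂≡0) (pos-* i ℓ)))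
                      (+-*-∸2 n e₂ e₂≡0))))))))

  triples-ℤ : ∀ i₃ i e₂ p c → + (i₃ ℕ.+ i ℕ.* e₂ ℕ.+ p ℕ.+ c) ≡ + i₃ + + i * + e₂ + + p + + c
  triples-ℤ i₃ i e₂ p c =
    trans (pos-+ (i₃ ℕ.+ i ℕ.* e₂ ℕ.+ p) c) (cong (_+ + c)
    (trans (pos-+ (i₃ ℕ.+ i ℕ.* e₂) p) (cong (_+ + p)
    (trans (pos-+ i₃ (i ℕ.* e₂)) (cong (_+_ (+ i₃)) (pos-* i e₂))))))

theorem4 : (n : ℕ) (G : SimpleGraph n) →
  let i = isolatedCount G
      ℓ = leafCount G
      n₂ = deg2Count G
      e₂ = k2Components G
      s = leafPairCommonNbr G
      m = leafDeg2Edges G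
      t₂₂ = deg2PairsSameClosedNbr G
      p₃ = p3Components G
      c₃ = k3Components G
  in + domCount G (+ n - + 3)
     ≡ + (n C 3)
       - (+ i * + ((n ∸ 1) C 2) + + ℓ * (+ n - + 2) + + n₂)
       + (+ (i C 2) * (+ n - + 2) + + i * + ℓ + + e₂ * (+ n - + 2) + + s + + m + + t₂₂)
       - (+ (i C 3) + + i * + e₂ + + p₃ + + c₃)
theorem4 n G = begin
  + domCount G (+ n - + 3)
    ≡⟨ rearrange (domCount G (+ n - + 3)) singles triples (n C 3) pairs (domCount-identity G) ⟩
  + (n C 3) - + singles + + pairs - + triples
    ≡⟨ cong₂ (λ a b → + (n C 3) - a + b - + triples)
             (singles-ℤ n i ((n ∸ 1) C 2) ℓ (deg2Count G) (small-leafCount n G))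
             (pairs-ℤ n (i C 2) i ℓ e₂ s m t₂₂ (small-isolatedPairs n G) (small-k2Components n G)) ⟩
  + (n C 3) - singlesℤ + pairsℤ - + triples
    ≡⟨ cong (+ (n C 3) - singlesℤ + pairsℤ -_) (triples-ℤ (i C 3) i e₂ p₃ c₃) ⟩
  + (n C 3) - singlesℤ + pairsℤ - triplesℤ ∎
  where
  open ≡-Reasoning
  i = isolatedCount G
  ℓ = leafCount G
  e₂ = k2Components G
  s = leafPairCommonNbr G
  m = leafDeg2Edges G
  t₂₂ = deg2PairsSameClosedNbr G
  p₃ = p3Components G
  c₃ = k3Components G
  singles = i ℕ.* ((n ∸ 1) C 2) ℕ.+ ℓ ℕ.* (n ∸ 2) ℕ.+ deg2Count G
  pairs = (i C 2) ℕ.* (n ∸ 2) ℕ.+ i ℕ.* ℓ ℕ.+ e₂ ℕ.* (n ∸ 2) ℕ.+ s ℕ.+ m ℕ.+ t₂₂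
  triples = i C 3 ℕ.+ i ℕ.* e₂ ℕ.+ p₃ ℕ.+ c₃
  singlesℤ = + i * + ((n ∸ 1) C 2) + + ℓ * (+ n - + 2) + + deg2Count G
  pairsℤ = + (i C 2) * (+ n - + 2) + + i * + ℓ + + e₂ * (+ n - + 2) + + s + + m + + t₂₂
  triplesℤ = + (i C 3) + + i * + e₂ + + p₃ + + c₃
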